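{- For any prime power $q$ and positive integer $n$, \[N(Q,x^n-1,x^n-1)=\frac{R}{\phi(R)}N(q^n-1,x^n-1,x^n-1),\] where $\phi$ is Euler's function and $R$ is the greatest divisor of $q^n-1$ coprime to $Q$.
   Context: Let $F=GF(q)$, $E=GF(q^n)$, and $Q$ the radical of $\frac{q^n-1}{(q-1)\gcd(n,q-1)}$. For $m\mid q^n-1$, $w\in E^*$ is $m$-free if $w=v^d$ with $v\in E$, $d\mid m$ implies $d=1$ (so $(q^n-1)$-free means primitive). For monic $H=\sum a_ix^i\in F[x]$, $H^\sigma(v)=\sum a_iv^{q^i}$; for a monic divisor $g$ of $x^n-1$, $w\in E$ is $g$-free if $w=H^\sigma(v)$ with $v\in E$, $H$ a monic divisor of $g$, implies $H=1$ ($x^n-1$-free means free over $F$). $N(m,g,h)$ is the number of $w\in E^*$ that are $m$-free and $g$-free with $w^{ -1}$ $h$-free. -}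

module Defs where

open import Level using (0ℓ)
open import Algebra.Bundles using (CommutativeRing)
open import Data.Nat as ℕ using (ℕ; zero; suc; _∸_; _≤_)
open import Data.Nat.ListAction using (product)
open import Data.Nat.Divisibility using (_∣_; _∣?_)
open import Data.Nat.Primality using (Prime; prime?)
open import Data.Nat.Coprimality using (Coprime; coprime?)
open import Data.List using (List; []; _∷_; _++_; [_]; replicate; length; filter; upTo; lookup)
open import Data.List.Relation.Unary.Any using (Any)
import Data.List.Relation.Unary.All
import Data.Unit
open import Data.List.Relation.Unary.AllPairs using (AllPairs)
open import Data.Fin using (Fin)
open import Data.Fin.Subset using (Subset; _∈_; ∣_∣)
open import Data.Product using (Σ; ∃; _×_; _,_)
open import Function.Bundles using (_⇔_)
open import Relation.Nullary using (¬_)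
open import Relation.Nullary.Decidable using (_×-dec_)
open import Relation.Binary.PropositionalEquality using (_≡_)

rad : ℕ → ℕ
rad a = product (filter (λ p → prime? p ×-dec (p ∣? a)) (upTo (suc a)))

φ : ℕ → ℕ
φ r = length (filter (λ k → coprime? k r) (Data.List.map suc (upTo r)))

IsPrimePower : ℕ → Set
IsPrimePower q = Σ ℕ λ p → Σ ℕ λ e → Prime p × 1 ≤ e × q ≡ p ℕ.^ e

record FiniteField : Set₁ where
  field
    commRing : CommutativeRing 0ℓ 0ℓ
  open CommutativeRing commRing public
  field
    1≉0      : ¬ (1# ≈ 0#)
    _⁻¹      : Carrier → Carrier
    inverseʳ : ∀ x → ¬ (x ≈ 0#) → (x * (x ⁻¹)) ≈ 1#
    elems    : List Carrier
    complete : ∀ x → Any (x ≈_) elems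
    distinct : AllPairs (λ x y → ¬ (x ≈ y)) elems

  card : ℕ
  card = length elems

  pow : Carrier → ℕ → Carrier
  pow x zero    = 1#
  pow x (suc k) = x * pow x k

module _ (E : FiniteField) (q : ℕ) where
  open FiniteField E

  -- F = GF(q) inside E: the fixed points of v ↦ v^q
  InF : Carrier → Set
  InF a = pow a q ≈ a

  -- polynomials: coefficient lists a₀ ∷ a₁ ∷ … (lowest degree first)
  Poly : Set
  Poly = List Carrier

  PolyOverF : Poly → Set
  PolyOverF = Data.List.Relation.Unary.All.All InF

  _≈ₚ_ : Poly → Poly → Set
  []       ≈ₚ []       = Data.Unit.⊤
  []       ≈ₚ (b ∷ bs) = (b ≈ 0#) × ([] ≈ₚ bs)
  (a ∷ as) ≈ₚ []       = (a ≈ 0#) × (as ≈ₚ [])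
  (a ∷ as) ≈ₚ (b ∷ bs) = (a ≈ b) × (as ≈ₚ bs)

  _+ₚ_ : Poly → Poly → Poly
  []       +ₚ bs       = bs
  (a ∷ as) +ₚ []       = a ∷ as
  (a ∷ as) +ₚ (b ∷ bs) = (a + b) ∷ (as +ₚ bs)

  scale : Carrier → Poly → Poly
  scale c = Data.List.map (c *_)

  _*ₚ_ : Poly → Poly → Poly
  []       *ₚ bs = []
  (a ∷ as) *ₚ bs = scale a bs +ₚ (0# ∷ (as *ₚ bs))

  Monic : Poly → Set
  Monic H = ∃ λ as → H ≡ as ++ [ 1# ]

  DividesF : Poly → Poly → Set
  DividesF H g = ∃ λ K → PolyOverF K × ((H *ₚ K) ≈ₚ g)

  -- H^σ(v) = Σ aᵢ v^(q^i)
  σapply : Poly → Carrier → Carrier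
  σapply []       v = 0#
  σapply (a ∷ as) v = (a * v) + σapply as (pow v q)

  -- x^n - 1  (for n ≥ 1)
  xⁿ-1 : ℕ → Poly
  xⁿ-1 n = (- 1#) ∷ (replicate (n ∸ 1) 0# ++ [ 1# ])

  MFree : ℕ → Carrier → Set
  MFree m w = ∀ (d : ℕ) (v : Carrier) → d ∣ m → pow v d ≈ w → d ≡ 1

  GFree : Poly → Carrier → Set
  GFree g w = ∀ (H : Poly) (v : Carrier) → PolyOverF H → Monic H → DividesF H g →
              σapply H v ≈ w → H ≈ₚ [ 1# ]

  NProp : ℕ → Poly → Poly → Carrier → Set
  NProp m g h w = ¬ (w ≈ 0#) × MFree m w × GFree g w × GFree h (w ⁻¹)

  -- "N(m,g,h) = k": the set of elements of E with NProp has exactly k elements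
  HasCountN : ℕ → Poly → Poly → ℕ → Set
  HasCountN m g h k =
    Σ (Subset card) λ S →
      (∀ (i : Fin card) → (i ∈ S) ⇔ NProp m g h (lookup elems i)) × ∣ S ∣ ≡ k

module Submission where

open import Defs
open import Data.Nat using (ℕ; zero; suc)

-- The unit group of E is cyclic: by Fermat and the root bound for xᴰ - 1, every prime
-- power exactly dividing m = qⁿ - 1 is the order of some unit, and units of coprime orders multiply.
-- Fix a generator γ. Then γʲ is M-free iff gcd(j, M) = 1, for every M whose primes divide m.
-- Put u = γ^(k t). As m = k (q - 1) gcd(n, q - 1), c = u^(q - 1) lies in F and cⁿ = 1, so
-- (u x)^q = u (c x^q); replacing a monic divisor H(x) of xⁿ - 1 by c^(-deg H) H(c x) then shows that
-- multiplication by u preserves (xⁿ - 1)-freeness of w and of w⁻¹, and it preserves rad(k)-freeness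
-- because every prime of k divides k t. Every prime of m not dividing k divides R, so γʲ is
-- (qⁿ - 1)-free iff it is rad(k)-free and gcd(j, R) = 1. Summing over the R shifts j ↦ j + k t, which
-- meet every residue class modulo R once since gcd(k, R) = 1, gives R N(qⁿ - 1, ..) = φ(R) N(rad k, ..).

module Arithmetic where

  open import Data.Nat
  open import Data.Nat.Properties
  open import Data.Nat.Divisibility
  open import Data.Nat.DivMod
  open import Data.Nat.Coprimality using (Coprime; coprime-divisor)
  import Data.Nat.Coprimality as Coprime
  open import Data.Nat.Primality
  open import Data.Nat.Primality.Factorisation using (factorise; factorisationHasAllPrimeFactors)
  open import Data.Nat.ListAction using (product)
  open import Data.Nat.ListAction.Properties using (∈⇒∣product)
  open import Data.Nat.Induction using (<-rec)
  open import Data.Nat.Tactic.RingSolver using (solve-∀)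
  open import Data.List using (List; []; _∷_; filter; upTo)
  import Data.List.Relation.Unary.All as All
  open import Data.List.Relation.Unary.All.Properties using (all-filter)
  open import Data.List.Membership.Propositional.Properties using (∈-filter⁺; ∈-filter⁻; ∈-upTo⁺)
  open import Data.Product
  open import Data.Sum using (inj₁; inj₂; [_,_]′)
  open import Data.Empty using (⊥-elim)
  open import Function using (_⇔_; mk⇔)
  open import Relation.Nullary
  open import Relation.Nullary.Decidable using (_×-dec_)
  open import Relation.Binary.PropositionalEquality

  private variable
    d m n p x y : ℕ

  prime>1 : Prime p → 1 < p
  prime>1 {p} (prime _) = nonTrivial⇒n>1 p

  prime≢1 : Prime p → p ≢ 1
  prime≢1 pp refl = <-irrefl refl (prime>1 pp)

  prime-factor : 1 < n → ∃[ p ] Prime p × p ∣ n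
  prime-factor {n} 1<n with factorise n {{>-nonZero (<-trans z<s 1<n)}}
  ... | record { factors = [] ; isFactorisation = n≡1 } = ⊥-elim (<-irrefl (sym n≡1) 1<n)
  ... | record { factors = p ∷ ps ; isFactorisation = n≡p*ps ; factorsPrime = pp All.∷ _ } =
    p , pp , subst (p ∣_) (sym n≡p*ps) (m∣m*n (product ps))

  prime-factor-of-divisor : .{{_ : NonZero n}} → d ∣ n → d ≢ 1 → ∃[ p ] Prime p × p ∣ d
  prime-factor-of-divisor {n} {0} 0∣n _ = ⊥-elim (≢-nonZero⁻¹ n (0∣⇒≡0 0∣n))
  prime-factor-of-divisor {d = 1}    _ d≢1 = ⊥-elim (d≢1 refl)
  prime-factor-of-divisor {d = 2+ _} _ _   = prime-factor (s≤s (s≤s z≤n))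

  coprime-by-primes : .{{_ : NonZero n}} → (∀ {p} → Prime p → p ∣ m → p ∤ n) → Coprime m n
  coprime-by-primes {n} no-common {d} (d∣m , d∣n) with d ≟ 1
  ... | yes d≡1 = d≡1
  ... | no d≢1 with p , pp , p∣d ← prime-factor-of-divisor d∣n d≢1 =
    ⊥-elim (no-common pp (∣-trans p∣d d∣m) (∣-trans p∣d d∣n))

  coprime⇒prime∤ : Coprime m n → Prime p → p ∣ m → p ∤ n
  coprime⇒prime∤ m⊥n pp p∣m p∣n = prime≢1 pp (m⊥n (p∣m , p∣n))

  coprime-*ˡ : .{{_ : NonZero n}} → Coprime x n → Coprime y n → Coprime (x * y) n
  coprime-*ˡ {x = x} {y} x⊥n y⊥n = coprime-by-primes λ pp p∣xy p∣n →
    [ (λ p∣x → coprime⇒prime∤ x⊥n pp p∣x p∣n) , (λ p∣y → coprime⇒prime∤ y⊥n pp p∣y p∣n) ]′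
      (euclidsLemma x y pp p∣xy)

  coprime-∣-primes : .{{_ : NonZero n}} → (∀ {p} → Prime p → p ∣ n → p ∣ m) → Coprime x m → Coprime x n
  coprime-∣-primes primes∣m x⊥m =
    coprime-by-primes λ pp p∣x p∣n → coprime⇒prime∤ x⊥m pp p∣x (primes∣m pp p∣n)

  coprime-∣-* : Coprime m n → m ∣ x → n ∣ x → m * n ∣ x
  coprime-∣-* {m} {n} m⊥n (divides y refl) n∣ym =
    subst (m * n ∣_) (*-comm m y)
      (*-monoʳ-∣ m (coprime-divisor (Coprime.sym m⊥n) (subst (n ∣_) (*-comm y m) n∣ym)))

  prime∣prime⇒≡ : Prime p → Prime d → d ∣ p → d ≡ p
  prime∣prime⇒≡ pp pd d∣p with prime⇒irreducible pp d∣p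
  ... | inj₁ d≡1 = ⊥-elim (prime≢1 pd d≡1)
  ... | inj₂ d≡p = d≡p

  prime∣^⇒≡ : ∀ e → Prime p → Prime d → d ∣ p ^ e → d ≡ p
  prime∣^⇒≡ zero pp pd d∣1 = ⊥-elim (prime≢1 pd (∣1⇒≡1 d∣1))
  prime∣^⇒≡ {p} (suc e) pp pd d∣p^[1+e] with euclidsLemma p (p ^ e) pd d∣p^[1+e]
  ... | inj₁ d∣p   = prime∣prime⇒≡ pp pd d∣p
  ... | inj₂ d∣p^e = prime∣^⇒≡ e pp pd d∣p^e

  prime-coprime : Prime p → .{{_ : NonZero n}} → p ∤ n → Coprime p n
  prime-coprime pp p∤n = coprime-by-primes λ pr r∣p r∣n →
    p∤n (subst (_∣ _) (prime∣prime⇒≡ pp pr r∣p) r∣n)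

  prime^-coprime : ∀ e → Prime p → .{{_ : NonZero n}} → p ∤ n → Coprime (p ^ e) n
  prime^-coprime e pp p∤n = coprime-by-primes λ pr r∣p^e r∣n →
    p∤n (subst (_∣ _) (prime∣^⇒≡ e pp pr r∣p^e) r∣n)

  prime^[1+e]>1 : ∀ e → Prime p → 1 < p ^ suc e
  prime^[1+e]>1 {p} e pp = <-≤-trans (prime>1 pp) (m≤m*n p (p ^ e) {{m^n≢0 p e {{prime⇒nonZero pp}}}})

  ∣p^[1+e]⇒∣p^e : ∀ e → Prime p → d ∣ p ^ suc e → d ≢ p ^ suc e → d ∣ p ^ e
  ∣p^[1+e]⇒∣p^e {p} {d} e pp (divides t p^[1+e]≡t*d) d≢p^[1+e] with t ≟ 1
  ... | yes refl = ⊥-elim (d≢p^[1+e] (sym (trans p^[1+e]≡t*d (*-identityˡ d))))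
  ... | no t≢1 = cancel-p p∣t
    where
    instance
      p-nonZero : NonZero p
      p-nonZero = prime⇒nonZero pp
    rearrange : ∀ a b c → a * b * c ≡ b * (a * c)
    rearrange = solve-∀
    t∣p^[1+e] : t ∣ p ^ suc e
    t∣p^[1+e] = divides d (trans p^[1+e]≡t*d (*-comm t d))
    p∣t : p ∣ t
    p∣t with r , pr , r∣t ← prime-factor-of-divisor {{m^n≢0 p (suc e)}} t∣p^[1+e] t≢1 =
      subst (_∣ t) (prime∣^⇒≡ (suc e) pp pr (∣-trans r∣t t∣p^[1+e])) r∣t
    cancel-p : p ∣ t → d ∣ p ^ e
    cancel-p (divides t′ refl) =
      divides t′ (*-cancelˡ-≡ (p ^ e) (t′ * d) p (trans p^[1+e]≡t*d (rearrange t′ p d)))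

  prime-power-split : Prime p → .{{_ : NonZero n}} → p ∣ n → ∃₂ λ e n′ → n ≡ p ^ suc e * n′ × p ∤ n′
  prime-power-split {p} pp {{n≢0}} = <-rec Split step _ {{n≢0}}
    where
    Split : ℕ → Set
    Split n = .{{_ : NonZero n}} → p ∣ n → ∃₂ λ e n′ → n ≡ p ^ suc e * n′ × p ∤ n′
    step : ∀ n → (∀ {m} → m < n → Split m) → Split n
    step n rec (divides n₁ n≡n₁*p) with p ∣? n₁
    ... | no p∤n₁ =
      0 , n₁ , trans n≡n₁*p (trans (*-comm n₁ p) (cong (_* n₁) (sym (*-identityʳ p)))) , p∤n₁
    ... | yes p∣n₁ = extend (rec n₁<n {{n₁≢0}} p∣n₁)
      where
      n₁≢0 : NonZero n₁
      n₁≢0 = ≢-nonZero λ { refl → ≢-nonZero⁻¹ n n≡n₁*p }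
      n₁<n : n₁ < n
      n₁<n = subst (n₁ <_) (sym n≡n₁*p) (m<m*n n₁ p {{n₁≢0}} (prime>1 pp))
      rearrange : ∀ a b c → a * b * c * a ≡ a * (a * b) * c
      rearrange = solve-∀
      extend : (∃₂ λ e n′ → n₁ ≡ p ^ suc e * n′ × p ∤ n′) → ∃₂ λ e n′ → n ≡ p ^ suc e * n′ × p ∤ n′
      extend (e , n′ , n₁≡p^[1+e]*n′ , p∤n′) =
        suc e , n′ , trans n≡n₁*p (trans (cong (_* p) n₁≡p^[1+e]*n′) (rearrange p (p ^ e) n′)) , p∤n′

  private
    rad-factors : ℕ → List ℕ
    rad-factors k = filter (λ p → prime? p ×-dec (p ∣? k)) (upTo (suc k))

    rad-factors-prime : ∀ k → All.All Prime (rad-factors k)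
    rad-factors-prime k = All.map proj₁ (all-filter (λ p → prime? p ×-dec (p ∣? k)) (upTo (suc k)))

  rad-nonZero : ∀ k → NonZero (rad k)
  rad-nonZero k = productOfPrimes≢0 (rad-factors-prime k)

  prime∣rad⇔prime∣ : ∀ {k} → .{{_ : NonZero k}} → Prime p → p ∣ rad k ⇔ p ∣ k
  prime∣rad⇔prime∣ {p} {k} pp = mk⇔
    (λ p∣rad → proj₂ (proj₂ (∈-filter⁻ (λ p → prime? p ×-dec (p ∣? k)) {xs = upTo (suc k)}
                 (factorisationHasAllPrimeFactors pp p∣rad (rad-factors-prime k)))))
    (λ p∣k → ∈⇒∣product
               (∈-filter⁺ (λ p → prime? p ×-dec (p ∣? k)) (∈-upTo⁺ (s≤s (∣⇒≤ p∣k))) (pp , p∣k)))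

  coprime-%⇔ : ∀ {r} → .{{_ : NonZero n}} → r ∣ n → Coprime (x % n) r ⇔ Coprime x r
  coprime-%⇔ r∣n = mk⇔
    (λ x%n⊥r {d} (d∣x , d∣r) → x%n⊥r (%-presˡ-∣ d∣x (∣-trans d∣r r∣n) , d∣r))
    (λ x⊥r {d} (d∣x%n , d∣r) → x⊥r (∣n∣m%n⇒∣m (∣-trans d∣r r∣n) d∣x%n , d∣r))

  coprime-+-multiple⇔ : ∀ {a} → .{{_ : NonZero a}} → (∀ {p} → Prime p → p ∣ a → p ∣ y) →
                        Coprime (x + y) a ⇔ Coprime x a
  coprime-+-multiple⇔ {y} {x} {a} primes∣y = mk⇔ to from
    where
    to : Coprime (x + y) a → Coprime x a
    to x+y⊥a = coprime-by-primes λ pp p∣x p∣a →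
      coprime⇒prime∤ x+y⊥a pp (∣m∣n⇒∣m+n p∣x (primes∣y pp p∣a)) p∣a
    from : Coprime x a → Coprime (x + y) a
    from x⊥a = coprime-by-primes λ {p} pp p∣x+y p∣a →
      coprime⇒prime∤ x⊥a pp (∣m+n∣m⇒∣n (subst (p ∣_) (+-comm x y) p∣x+y) (primes∣y pp p∣a)) p∣a

  %≡⇒∣∸ : .{{_ : NonZero n}} → x % n ≡ y % n → x ≤ y → n ∣ y ∸ x
  %≡⇒∣∸ {n} {x} {y} x%n≡y%n x≤y = divides (y / n ∸ x / n) (begin
    y ∸ x                                      ≡⟨ cong₂ _∸_ (m≡m%n+[m/n]*n y n) (m≡m%n+[m/n]*n x n) ⟩
    (y % n + y / n * n) ∸ (x % n + x / n * n)  ≡⟨ cong (λ r → (y % n + y / n * n) ∸ (r + x / n * n)) x%n≡y%n ⟩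
    (y % n + y / n * n) ∸ (y % n + x / n * n)  ≡⟨ [m+n]∸[m+o]≡n∸o (y % n) _ _ ⟩
    y / n * n ∸ x / n * n                      ≡⟨ *-distribʳ-∸ n (y / n) (x / n) ⟨
    (y / n ∸ x / n) * n                        ∎)
    where open ≡-Reasoning

  ∣∸⇒≡ : .{{_ : NonZero n}} → n ∣ y ∸ x → x ≤ y → y < n → x ≡ y
  ∣∸⇒≡ {n} {y} {x} n∣y∸x x≤y y<n with y ∸ x in y∸x≡
  ... | zero  = ≤-antisym x≤y (m∸n≡0⇒m≤n y∸x≡)
  ... | suc d = ⊥-elim (>⇒∤ {n = suc d} (subst (_< n) y∸x≡ (≤-<-trans (m∸n≤m y x) y<n)) n∣y∸x)

  injective<-by-≤ : ∀ {A : Set} {_≈_ : A → A → Set} → (∀ {u v} → u ≈ v → v ≈ u) → (f : ℕ → A) →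
                    (∀ {i j} → i ≤ j → j < n → f i ≈ f j → i ≡ j) →
                    ∀ {i j} → i < n → j < n → f i ≈ f j → i ≡ j
  injective<-by-≤ sym≈ f ordered {i} {j} i<n j<n fi≈fj with ≤-total i j
  ... | inj₁ i≤j = ordered i≤j j<n fi≈fj
  ... | inj₂ j≤i = sym (ordered j≤i i<n (sym≈ fi≈fj))

  +-*-%-injective : ∀ {a c i j} → .{{_ : NonZero n}} → Coprime n a → i < n → j < n →
                    (c + a * i) % n ≡ (c + a * j) % n → i ≡ j
  +-*-%-injective {n} {a} {c} n⊥a = injective<-by-≤ {_≈_ = _≡_} sym (λ i → (c + a * i) % n) ordered
    where
    ordered : ∀ {i j} → i ≤ j → j < n → (c + a * i) % n ≡ (c + a * j) % n → i ≡ j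
    ordered {i} {j} i≤j j<n eq = ∣∸⇒≡ (coprime-divisor n⊥a n∣a[j∸i]) i≤j j<n
      where
      n∣a[j∸i] : n ∣ a * (j ∸ i)
      n∣a[j∸i] = subst (n ∣_) (trans ([m+n]∸[m+o]≡n∸o c (a * j) (a * i)) (sym (*-distribˡ-∸ a j i)))
                   (%≡⇒∣∸ eq (+-monoʳ-≤ c (*-monoʳ-≤ a i≤j)))

module Sums where

  open import Data.Nat
  open import Data.Nat.Properties using (+-*-semiring; <⇒≱; ≤-reflexive)
  open import Algebra.Properties.Semiring.Sum +-*-semiring public
    using (sum; sum-syntax; sum-cong-≗; sum-permute; ∑-comm; *-distribˡ-sum; *-distribʳ-sum)
  open import Data.Fin as Fin using (Fin; toℕ; fromℕ<)
  import Data.Fin.Properties as Fin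
  open import Data.Fin.Permutation using (Permutation; permutation)
  open import Data.Fin.Subset using (Subset; ∣_∣)
  open import Data.Fin.Subset.Properties using (_∈?_; drop-there)
  open import Data.Vec using (_∷_; []; there)
  open import Data.Bool using (true; false)
  open import Data.List using (filter; applyUpTo; length)
  open import Data.Product
  open import Data.Empty using (⊥-elim)
  open import Function using (_∘_; Injective; _⇔_; Equivalence; mk⇔)
  open import Relation.Nullary
  open import Relation.Binary.PropositionalEquality

  𝟙 : ∀ {P : Set} → Dec P → ℕ
  𝟙 (yes _) = 1
  𝟙 (no _)  = 0

  𝟙-cong : ∀ {P Q : Set} → P ⇔ Q → (p? : Dec P) (q? : Dec Q) → 𝟙 p? ≡ 𝟙 q?
  𝟙-cong P⇔Q (yes _) (yes _) = refl
  𝟙-cong P⇔Q (yes p) (no ¬q) = ⊥-elim (¬q (Equivalence.to P⇔Q p))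
  𝟙-cong P⇔Q (no ¬p) (yes q) = ⊥-elim (¬p (Equivalence.from P⇔Q q))
  𝟙-cong P⇔Q (no _)  (no _)  = refl

  𝟙-× : ∀ {P Q R : Set} → P ⇔ (Q × R) → (p? : Dec P) (q? : Dec Q) (r? : Dec R) → 𝟙 p? ≡ 𝟙 q? * 𝟙 r?
  𝟙-× P⇔Q×R p? (yes q) (yes r) = 𝟙-cong P⇔Q×R p? (yes (q , r))
  𝟙-× P⇔Q×R p? (yes q) (no ¬r) = 𝟙-cong P⇔Q×R p? (no (¬r ∘ proj₂))
  𝟙-× P⇔Q×R p? (no ¬q) r?      = 𝟙-cong P⇔Q×R p? (no (¬q ∘ proj₁))

  ∑-const : ∀ n c → ∑[ i < n ] c ≡ n * c
  ∑-const zero    c = refl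
  ∑-const (suc n) c = cong (c +_) (∑-const n c)

  length-filter≡∑𝟙 : ∀ {P : ℕ → Set} (P? : ∀ x → Dec (P x)) (f : ℕ → ℕ) n →
                     length (filter P? (applyUpTo f n)) ≡ ∑[ i < n ] 𝟙 (P? (f (toℕ i)))
  length-filter≡∑𝟙 P? f zero = refl
  length-filter≡∑𝟙 P? f (suc n) with P? (f 0)
  ... | yes _ = cong suc (length-filter≡∑𝟙 P? (f ∘ suc) n)
  ... | no _  = length-filter≡∑𝟙 P? (f ∘ suc) n

  ∑𝟙-∈-∷ : ∀ {n s} (S : Subset n) → ∑[ i < n ] 𝟙 (i ∈? S) ≡ ∑[ i < n ] 𝟙 (Fin.suc i ∈? s ∷ S)
  ∑𝟙-∈-∷ S = sum-cong-≗ λ i → 𝟙-cong (mk⇔ there drop-there) (i ∈? S) _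

  ∣S∣≡∑𝟙 : ∀ {n} (S : Subset n) → ∣ S ∣ ≡ ∑[ i < n ] 𝟙 (i ∈? S)
  ∣S∣≡∑𝟙 []          = refl
  ∣S∣≡∑𝟙 (true ∷ S)  = cong suc (trans (∣S∣≡∑𝟙 S) (∑𝟙-∈-∷ S))
  ∣S∣≡∑𝟙 (false ∷ S) = trans (∣S∣≡∑𝟙 S) (∑𝟙-∈-∷ S)

  injective⇒surjective : ∀ {m n} (f : Fin m → Fin n) → n ≤ m → Injective _≡_ _≡_ f →
                         ∀ y → ∃ λ x → f x ≡ y
  injective⇒surjective {m} {suc n} f n≤m f-inj y with Fin.any? (λ x → f x Fin.≟ y)
  ... | yes fx≡y = fx≡y
  ... | no ∄x = ⊥-elim (<⇒≱ n≤m (Fin.injective⇒≤ f-avoiding-y-injective))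
    where
    f-avoiding-y : Fin m → Fin n
    f-avoiding-y x = Fin.punchOut {i = y} λ y≡fx → ∄x (x , sym y≡fx)
    f-avoiding-y-injective : Injective _≡_ _≡_ f-avoiding-y
    f-avoiding-y-injective = f-inj ∘ Fin.punchOut-injective {i = y} _ _

  injective⇒permutation : ∀ {m n} (f : Fin m → Fin n) → m ≡ n → Injective _≡_ _≡_ f → Permutation m n
  injective⇒permutation f m≡n f-inj =
    permutation f (proj₁ ∘ surj) (proj₂ ∘ surj) (λ x → f-inj (proj₂ (surj (f x))))
    where
    surj : ∀ y → ∃ λ x → f x ≡ y
    surj = injective⇒surjective f (≤-reflexive (sym m≡n)) f-inj

  ∑-reindex : ∀ {n} (f : ℕ → ℕ) (π : ℕ → ℕ) → (∀ {i} → i < n → π i < n) →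
              (∀ {i j} → i < n → j < n → π i ≡ π j → i ≡ j) →
              ∑[ i < n ] f (π (toℕ i)) ≡ ∑[ i < n ] f (toℕ i)
  ∑-reindex {n} f π π< π-injective = begin
    ∑[ i < n ] f (π (toℕ i))   ≡⟨ sum-cong-≗ (λ i → cong f (Fin.toℕ-fromℕ< (π< (Fin.toℕ<n i)))) ⟨
    ∑[ i < n ] f (toℕ (πᶠ i))  ≡⟨ sum-permute (f ∘ toℕ) (injective⇒permutation πᶠ refl πᶠ-injective) ⟨
    ∑[ i < n ] f (toℕ i)       ∎
    where
    open ≡-Reasoning
    πᶠ : Fin n → Fin n
    πᶠ i = fromℕ< (π< (Fin.toℕ<n i))
    πᶠ-injective : Injective _≡_ _≡_ πᶠ
    πᶠ-injective {i} {j} πᶠi≡πᶠj = Fin.toℕ-injective (π-injective (Fin.toℕ<n i) (Fin.toℕ<n j)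
      (trans (sym (Fin.toℕ-fromℕ< _)) (trans (cong toℕ πᶠi≡πᶠj) (Fin.toℕ-fromℕ< _))))

module Totient where

  open Arithmetic using (coprime-%⇔; +-*-%-injective)
  open Sums
  open import Data.Nat using (NonZero; _%_; _+_; _*_)
  import Data.Nat.Properties as ℕ
  open import Data.Nat.DivMod using (m%n<n)
  open import Data.Nat.Divisibility using (_∣_; ∣-refl)
  open import Data.Nat.Coprimality as Coprime using (Coprime; coprime?)
  open import Data.Fin using (toℕ)
  open import Data.List using (length; filter; applyUpTo)
  open import Function using (_∘_)
  import Data.List.Properties as List
  open import Relation.Binary.PropositionalEquality as ≡ using (_≡_)
  open ≡.≡-Reasoning

  𝟙-coprime-% : ∀ {r n} → .{{_ : NonZero n}} → r ∣ n →
                ∀ x → 𝟙 (coprime? (x % n) r) ≡ 𝟙 (coprime? x r)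
  𝟙-coprime-% {r} {n} r∣n x = 𝟙-cong (coprime-%⇔ r∣n) (coprime? (x % n) r) (coprime? x r)

  ∑𝟙-coprime-affine : ∀ {r a} → .{{_ : NonZero r}} → Coprime r a → ∀ c →
                      ∑[ i < r ] 𝟙 (coprime? (c + a * toℕ i) r) ≡ ∑[ i < r ] 𝟙 (coprime? (toℕ i) r)
  ∑𝟙-coprime-affine {r} {a} r⊥a c = begin
    ∑[ i < r ] 𝟙 (coprime? (c + a * toℕ i) r)
      ≡⟨ sum-cong-≗ {r} (λ i → 𝟙-coprime-% {r} ∣-refl (c + a * toℕ i)) ⟨
    ∑[ i < r ] 𝟙 (coprime? ((c + a * toℕ i) % r) r)
      ≡⟨ ∑-reindex (λ x → 𝟙 (coprime? x r)) (λ i → (c + a * i) % r) (λ _ → m%n<n _ r) (+-*-%-injective r⊥a) ⟩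
    ∑[ i < r ] 𝟙 (coprime? (toℕ i) r)
      ∎

  φ≡∑𝟙-coprime : ∀ r → .{{_ : NonZero r}} → φ r ≡ ∑[ i < r ] 𝟙 (coprime? (toℕ i) r)
  φ≡∑𝟙-coprime r = begin
    φ r
      ≡⟨ ≡.cong (length ∘ filter (λ x → coprime? x r)) (List.map-upTo suc r) ⟩
    length (filter (λ x → coprime? x r) (applyUpTo suc r))
      ≡⟨ length-filter≡∑𝟙 (λ x → coprime? x r) suc r ⟩
    ∑[ i < r ] 𝟙 (coprime? (suc (toℕ i)) r)
      ≡⟨ sum-cong-≗ {r} (λ i → ≡.cong (λ x → 𝟙 (coprime? (suc x) r)) (ℕ.*-identityˡ (toℕ i))) ⟨
    ∑[ i < r ] 𝟙 (coprime? (1 + 1 * toℕ i) r)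
      ≡⟨ ∑𝟙-coprime-affine (Coprime.sym (Coprime.1-coprimeTo r)) 1 ⟩
    ∑[ i < r ] 𝟙 (coprime? (toℕ i) r)
      ∎

module FieldArithmetic (E : FiniteField) where

  open FiniteField E
  import Data.Nat as ℕ
  import Data.Nat.Properties as ℕ
  open import Data.Nat.Divisibility using (_∣_; divides)
  open import Relation.Binary.PropositionalEquality as ≡ using (_≡_)
  open import Relation.Binary.Reasoning.Setoid setoid

  private variable
    x y z : Carrier

  inverseˡ : x ≉ 0# → x ⁻¹ * x ≈ 1#
  inverseˡ {x} x≉0 = trans (*-comm (x ⁻¹) x) (inverseʳ x x≉0)

  ⁻¹-cancelˡ : ∀ y → x ≉ 0# → x ⁻¹ * (x * y) ≈ y
  ⁻¹-cancelˡ {x} y x≉0 = begin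
    x ⁻¹ * (x * y) ≈⟨ *-assoc _ _ _ ⟨
    x ⁻¹ * x * y   ≈⟨ *-congʳ (inverseˡ x≉0) ⟩
    1# * y         ≈⟨ *-identityˡ y ⟩
    y              ∎

  *-cancelˡ : x ≉ 0# → x * y ≈ x * z → y ≈ z
  *-cancelˡ {x} {y} {z} x≉0 xy≈xz = begin
    y              ≈⟨ ⁻¹-cancelˡ y x≉0 ⟨
    x ⁻¹ * (x * y) ≈⟨ *-congˡ xy≈xz ⟩
    x ⁻¹ * (x * z) ≈⟨ ⁻¹-cancelˡ z x≉0 ⟩
    z              ∎

  *-≉0 : x ≉ 0# → y ≉ 0# → x * y ≉ 0#
  *-≉0 {x} x≉0 y≉0 xy≈0 = y≉0 (*-cancelˡ x≉0 (trans xy≈0 (sym (zeroʳ x))))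

  ⁻¹-≉0 : x ≉ 0# → x ⁻¹ ≉ 0#
  ⁻¹-≉0 {x} x≉0 x⁻¹≈0 = 1≉0 (begin
    1#       ≈⟨ inverseʳ x x≉0 ⟨
    x * x ⁻¹ ≈⟨ *-congˡ x⁻¹≈0 ⟩
    x * 0#   ≈⟨ zeroʳ x ⟩
    0#       ∎)

  ≉0-resp-≈ : x ≈ y → x ≉ 0# → y ≉ 0#
  ≉0-resp-≈ x≈y x≉0 y≈0 = x≉0 (trans x≈y y≈0)

  inverse-unique : x ≉ 0# → x * y ≈ 1# → y ≈ x ⁻¹
  inverse-unique {x} x≉0 xy≈1 = *-cancelˡ x≉0 (trans xy≈1 (sym (inverseʳ x x≉0)))

  ⁻¹-cong : x ≉ 0# → x ≈ y → x ⁻¹ ≈ y ⁻¹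
  ⁻¹-cong {x} x≉0 x≈y =
    inverse-unique (≉0-resp-≈ x≈y x≉0) (trans (*-congʳ (sym x≈y)) (inverseʳ x x≉0))

  *-interchange : ∀ a b c d → a * b * (c * d) ≈ a * c * (b * d)
  *-interchange a b c d = begin
    a * b * (c * d)   ≈⟨ *-assoc a b (c * d) ⟩
    a * (b * (c * d)) ≈⟨ *-congˡ (*-assoc b c d) ⟨
    a * (b * c * d)   ≈⟨ *-congˡ (*-congʳ (*-comm b c)) ⟩
    a * (c * b * d)   ≈⟨ *-congˡ (*-assoc c b d) ⟩
    a * (c * (b * d)) ≈⟨ *-assoc a c (b * d) ⟨
    a * c * (b * d)   ∎

  ⁻¹-distrib-* : x ≉ 0# → y ≉ 0# → (x * y) ⁻¹ ≈ x ⁻¹ * y ⁻¹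
  ⁻¹-distrib-* {x} {y} x≉0 y≉0 = sym (inverse-unique (*-≉0 x≉0 y≉0) (begin
    x * y * (x ⁻¹ * y ⁻¹)   ≈⟨ *-interchange x y (x ⁻¹) (y ⁻¹) ⟩
    x * x ⁻¹ * (y * y ⁻¹)   ≈⟨ *-cong (inverseʳ x x≉0) (inverseʳ y y≉0) ⟩
    1# * 1#                 ≈⟨ *-identityˡ 1# ⟩
    1#                      ∎))

  1⁻¹≈1 : 1# ⁻¹ ≈ 1#
  1⁻¹≈1 = sym (inverse-unique 1≉0 (*-identityˡ 1#))

  pow-cong : ∀ n → x ≈ y → pow x n ≈ pow y n
  pow-cong zero    x≈y = refl
  pow-cong (suc n) x≈y = *-cong x≈y (pow-cong n x≈y)

  pow-+ : ∀ x a b → pow x (a ℕ.+ b) ≈ pow x a * pow x b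
  pow-+ x zero    b = sym (*-identityˡ _)
  pow-+ x (suc a) b = trans (*-congˡ (pow-+ x a b)) (sym (*-assoc _ _ _))

  pow-distrib-* : ∀ x y n → pow (x * y) n ≈ pow x n * pow y n
  pow-distrib-* x y zero    = sym (*-identityˡ 1#)
  pow-distrib-* x y (suc n) = trans (*-congˡ (pow-distrib-* x y n)) (*-interchange x y _ _)

  pow-1# : ∀ n → pow 1# n ≈ 1#
  pow-1# zero    = refl
  pow-1# (suc n) = trans (*-identityˡ _) (pow-1# n)

  pow-* : ∀ x a b → pow x (a ℕ.* b) ≈ pow (pow x a) b
  pow-* x zero    b = sym (pow-1# b)
  pow-* x (suc a) b = begin
    pow x (b ℕ.+ a ℕ.* b)        ≈⟨ pow-+ x b (a ℕ.* b) ⟩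
    pow x b * pow x (a ℕ.* b)    ≈⟨ *-congˡ (pow-* x a b) ⟩
    pow x b * pow (pow x a) b    ≈⟨ pow-distrib-* x (pow x a) b ⟨
    pow (x * pow x a) b          ∎

  pow-≉0 : ∀ n → x ≉ 0# → pow x n ≉ 0#
  pow-≉0 zero    x≉0 = 1≉0
  pow-≉0 (suc n) x≉0 = *-≉0 x≉0 (pow-≉0 n x≉0)

  pow-0# : ∀ n → .{{_ : ℕ.NonZero n}} → pow 0# n ≈ 0#
  pow-0# (suc n) = zeroˡ (pow 0# n)

  pow-⁻¹ : ∀ n → x ≉ 0# → pow (x ⁻¹) n ≈ pow x n ⁻¹
  pow-⁻¹ zero    x≉0 = sym 1⁻¹≈1
  pow-⁻¹ (suc n) x≉0 = trans (*-congˡ (pow-⁻¹ n x≉0)) (sym (⁻¹-distrib-* x≉0 (pow-≉0 n x≉0)))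

  pow≈1-∣ : ∀ a {b} → pow x a ≈ 1# → a ∣ b → pow x b ≈ 1#
  pow≈1-∣ {x} a xᵃ≈1 (divides c ≡.refl) = begin
    pow x (c ℕ.* a)  ≡⟨ ≡.cong (pow x) (ℕ.*-comm c a) ⟩
    pow x (a ℕ.* c)  ≈⟨ pow-* x a c ⟩
    pow (pow x a) c  ≈⟨ pow-cong c xᵃ≈1 ⟩
    pow 1# c         ≈⟨ pow-1# c ⟩
    1#               ∎

  pow-cancel : ∀ a b → x ≉ 0# → pow x (a ℕ.+ b) ≈ pow x a → pow x b ≈ 1#
  pow-cancel {x} a b x≉0 xᵃ⁺ᵇ≈xᵃ =
    *-cancelˡ (pow-≉0 a x≉0) (trans (sym (pow-+ x a b)) (trans xᵃ⁺ᵇ≈xᵃ (sym (*-identityʳ _))))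

module Enumeration (E : FiniteField) where

  open FiniteField E
  open import Data.Nat as ℕ using (_∸_)
  open import Data.Fin as Fin using (Fin; punchIn; punchOut; cast)
  import Data.Fin.Properties as Fin
  open import Data.List using (List; _∷_; lookup)
  open import Data.List.Membership.Propositional.Properties using (∈-lookup)
  open import Data.List.Relation.Unary.Any as Any using (Any)
  open import Data.List.Relation.Unary.Any.Properties using (lookup-index)
  import Data.List.Relation.Unary.All as All
  open import Data.List.Relation.Unary.AllPairs using (AllPairs; _∷_)
  open import Data.Empty using (⊥-elim)
  open import Function using (_∘_)
  open import Relation.Nullary using (yes; no; Dec)
  open import Relation.Binary.PropositionalEquality as ≡ using (_≡_; _≢_)

  private variable
    x y : Carrier

  lookup-injective : ∀ {xs : List Carrier} → AllPairs _≉_ xs →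
                     ∀ {i j} → lookup xs i ≈ lookup xs j → i ≡ j
  lookup-injective (_   ∷ _) {Fin.zero}  {Fin.zero}  _ = ≡.refl
  lookup-injective (x≉_ ∷ _) {Fin.zero}  {Fin.suc j} x≈ = ⊥-elim (All.lookup x≉_ (∈-lookup j) x≈)
  lookup-injective (x≉_ ∷ _) {Fin.suc i} {Fin.zero}  ≈x = ⊥-elim (All.lookup x≉_ (∈-lookup i) (sym ≈x))
  lookup-injective (_   ∷ d) {Fin.suc i} {Fin.suc j} eq = ≡.cong Fin.suc (lookup-injective d eq)

  index : Carrier → Fin card
  index x = Any.index (complete x)

  ≈-lookup-index : ∀ x → x ≈ lookup elems (index x)
  ≈-lookup-index x = lookup-index (complete x)

  index-injective : index x ≡ index y → x ≈ y
  index-injective {x} {y} eq =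
    trans (≈-lookup-index x) (trans (reflexive (≡.cong (lookup elems) eq)) (sym (≈-lookup-index y)))

  index-cong : x ≈ y → index x ≡ index y
  index-cong {x} {y} x≈y =
    lookup-injective distinct (trans (sym (≈-lookup-index x)) (trans x≈y (≈-lookup-index y)))

  index-lookup : ∀ i → index (lookup elems i) ≡ i
  index-lookup i = lookup-injective distinct (sym (≈-lookup-index (lookup elems i)))

  infix 4 _≈?_
  _≈?_ : ∀ x y → Dec (x ≈ y)
  x ≈? y with index x Fin.≟ index y
  ... | yes eq = yes (index-injective eq)
  ... | no neq = no (neq ∘ index-cong)

  m : ℕ
  m = card ∸ 1

  card≡1+m : card ≡ suc m
  card≡1+m = inhabited⇒≡suc card (index 0#)
    where
    inhabited⇒≡suc : ∀ n → Fin n → n ≡ suc (n ∸ 1)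
    inhabited⇒≡suc (suc n) _ = ≡.refl

  private
    position : Carrier → Fin (suc m)
    position x = cast card≡1+m (index x)

    element : Fin (suc m) → Carrier
    element i = lookup elems (cast (≡.sym card≡1+m) i)

    ≈-element-position : ∀ x → x ≈ element (position x)
    ≈-element-position x = trans (≈-lookup-index x)
      (reflexive (≡.cong (lookup elems) (≡.sym (Fin.cast-involutive (≡.sym card≡1+m) card≡1+m (index x)))))

    position-element : ∀ i → position (element i) ≡ i
    position-element i =
      ≡.trans (≡.cong (cast card≡1+m) (index-lookup _)) (Fin.cast-involutive card≡1+m (≡.sym card≡1+m) i)

    position-cong : x ≈ y → position x ≡ position y
    position-cong = ≡.cong (cast card≡1+m) ∘ index-cong

    position-injective : position x ≡ position y → x ≈ y
    position-injective {x} {y} eq =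
      trans (≈-element-position x) (trans (reflexive (≡.cong element eq)) (sym (≈-element-position y)))

    element-injective : ∀ {i j} → element i ≈ element j → i ≡ j
    element-injective {i} {j} eq =
      ≡.trans (≡.sym (position-element i)) (≡.trans (position-cong eq) (position-element j))

  nonzero : Fin m → Carrier
  nonzero j = element (punchIn (position 0#) j)

  nonzero-≉0 : ∀ j → nonzero j ≉ 0#
  nonzero-≉0 j nonzero≈0 = Fin.punchInᵢ≢i (position 0#) j
    (≡.trans (≡.sym (position-element _)) (position-cong nonzero≈0))

  nonzero-injective : ∀ {i j} → nonzero i ≈ nonzero j → i ≡ j
  nonzero-injective = Fin.punchIn-injective (position 0#) _ _ ∘ element-injective

  nonzero-index : x ≉ 0# → Fin m
  nonzero-index x≉0 = punchOut (x≉0 ∘ position-injective ∘ ≡.sym)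

  nonzero-index-≈ : (x≉0 : x ≉ 0#) → nonzero (nonzero-index x≉0) ≈ x
  nonzero-index-≈ {x} x≉0 =
    sym (trans (≈-element-position x) (reflexive (≡.cong element (≡.sym (Fin.punchIn-punchOut _)))))

module Fermat (E : FiniteField) where

  open FiniteField E
  open FieldArithmetic E
  open Enumeration E
  open Sums using (injective⇒permutation)
  open import Data.Fin as Fin using (Fin)
  open import Function using (_∘_)
  open import Algebra.Properties.CommutativeMonoid.Sum *-commutativeMonoid
    using () renaming (sum to ∏; sum-cong-≋ to ∏-cong; ∑-distrib-+ to ∏-distrib-*;
                       sum-permute to ∏-permute)
  open import Relation.Binary.PropositionalEquality as ≡ using (_≡_)
  open import Relation.Binary.Reasoning.Setoid setoid

  ∏-const : ∀ n x → ∏ {n} (λ _ → x) ≈ pow x n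
  ∏-const zero    x = refl
  ∏-const (suc n) x = *-congˡ (∏-const n x)

  ∏-≉0 : ∀ {n} (f : Fin n → Carrier) → (∀ i → f i ≉ 0#) → ∏ f ≉ 0#
  ∏-≉0 {zero}  f f≉0 = 1≉0
  ∏-≉0 {suc n} f f≉0 = *-≉0 (f≉0 Fin.zero) (∏-≉0 (f ∘ Fin.suc) (f≉0 ∘ Fin.suc))

  fermat : ∀ {x} → x ≉ 0# → pow x m ≈ 1#
  fermat {x} x≉0 = *-cancelˡ (∏-≉0 nonzero nonzero-≉0) (begin
    ∏ nonzero * pow x m                ≈⟨ *-comm _ _ ⟩
    pow x m * ∏ nonzero                ≈⟨ *-congʳ (∏-const m x) ⟨
    ∏ {m} (λ _ → x) * ∏ nonzero        ≈⟨ ∏-distrib-* (λ _ → x) nonzero ⟨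
    ∏ (λ j → x * nonzero j)            ≈⟨ ∏-cong (λ j → nonzero-index-≈ (x·nonzero≉0 j)) ⟨
    ∏ (λ j → nonzero (π j))            ≈⟨ ∏-permute nonzero (injective⇒permutation π ≡.refl π-injective) ⟨
    ∏ nonzero                          ≈⟨ *-identityʳ _ ⟨
    ∏ nonzero * 1#                     ∎)
    where
    x·nonzero≉0 : ∀ j → x * nonzero j ≉ 0#
    x·nonzero≉0 j = *-≉0 x≉0 (nonzero-≉0 j)
    π : Fin m → Fin m
    π j = nonzero-index (x·nonzero≉0 j)
    π-injective : ∀ {i j} → π i ≡ π j → i ≡ j
    π-injective {i} {j} πi≡πj = nonzero-injective (*-cancelˡ x≉0 (begin
      x * nonzero i   ≈⟨ nonzero-index-≈ (x·nonzero≉0 i) ⟨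
      nonzero (π i)   ≡⟨ ≡.cong nonzero πi≡πj ⟩
      nonzero (π j)   ≈⟨ nonzero-index-≈ (x·nonzero≉0 j) ⟩
      x * nonzero j   ∎))

module RootBound (E : FiniteField) where

  open FiniteField E
  open FieldArithmetic E
  open import Data.Nat as ℕ using (_≤_; z≤n; s≤s)
  open import Data.List using (List; []; _∷_; length)
  open import Data.List.Relation.Unary.All using (All; []; _∷_)
  open import Data.List.Relation.Unary.AllPairs using (AllPairs; []; _∷_)
  open import Data.Product using (∃; _×_; _,_)
  open import Data.Empty using (⊥-elim)
  open import Data.Maybe using (nothing)
  open import Function using (_∘_)
  open import Relation.Binary.Reasoning.Setoid setoid
  open import Tactic.RingSolver.Core.AlmostCommutativeRing using (fromCommutativeRing)
  open import Tactic.RingSolver.NonReflective (fromCommutativeRing commRing (λ _ → nothing))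

  data DegreeAtMost : ℕ → (Carrier → Carrier) → Set where
    const  : ∀ {f} b → (∀ x → f x ≈ b) → DegreeAtMost 0 f
    horner : ∀ {N f} b g → DegreeAtMost N g → (∀ x → f x ≈ b + x * g x) → DegreeAtMost (suc N) f

  data MonicOfDegree : ℕ → (Carrier → Carrier) → Set where
    one    : ∀ {f} → (∀ x → f x ≈ 1#) → MonicOfDegree 0 f
    horner : ∀ {N f} b g → MonicOfDegree N g → (∀ x → f x ≈ b + x * g x) → MonicOfDegree (suc N) f

  private variable
    N : ℕ
    f g : Carrier → Carrier

  monic⇒degreeAtMost : MonicOfDegree N f → DegreeAtMost N f
  monic⇒degreeAtMost (one f≈1)             = const 1# f≈1
  monic⇒degreeAtMost (horner b g mg f≈b+xg) = horner b g (monic⇒degreeAtMost mg) f≈b+xg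

  degreeAtMost-scale : ∀ r → DegreeAtMost N f → DegreeAtMost N (λ x → r * f x)
  degreeAtMost-scale r (const b f≈b) = const (r * b) (λ x → *-congˡ (f≈b x))
  degreeAtMost-scale r (horner b g dg f≈b+xg) =
    horner (r * b) (λ x → r * g x) (degreeAtMost-scale r dg) λ x → trans (*-congˡ (f≈b+xg x))
      (solve 4 (λ r b x gx → (r ⊗ (b ⊕ x ⊗ gx)) ⊜ (r ⊗ b ⊕ x ⊗ (r ⊗ gx))) refl r b x (g x))

  monic-+-degree< : MonicOfDegree (suc N) f → DegreeAtMost N g → MonicOfDegree (suc N) (λ x → f x + g x)
  monic-+-degree< (horner b f′ (one f′≈1) f≈b+xf′) (const c g≈c) =
    horner (b + c) f′ (one f′≈1) λ x → trans (+-cong (f≈b+xf′ x) (g≈c x))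
      (solve 4 (λ b x fx c → (b ⊕ x ⊗ fx ⊕ c) ⊜ (b ⊕ c ⊕ x ⊗ fx)) refl b x (f′ x) c)
  monic-+-degree< (horner b f′ mf′ f≈b+xf′) (horner c g′ dg′ g≈c+xg′) =
    horner (b + c) (λ x → f′ x + g′ x) (monic-+-degree< mf′ dg′) λ x →
      trans (+-cong (f≈b+xf′ x) (g≈c+xg′ x))
        (solve 5 (λ b x fx c gx → (b ⊕ x ⊗ fx ⊕ (c ⊕ x ⊗ gx)) ⊜ (b ⊕ c ⊕ x ⊗ (fx ⊕ gx)))
          refl b x (f′ x) c (g′ x))

  ≈-∸+ : ∀ x r → x ≈ (x - r) + r
  ≈-∸+ x r = begin
    x              ≈⟨ +-identityʳ x ⟨
    x + 0#         ≈⟨ +-congˡ (-‿inverseˡ r) ⟨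
    x + (- r + r)  ≈⟨ +-assoc x (- r) r ⟨
    x - r + r      ∎

  -- If f x = b + x g x and g x = g r + (x - r) h x, then f x = f r + (x - r) (g x + r h x).
  monic-divide : MonicOfDegree (suc N) f → ∀ r →
                 ∃ λ h → MonicOfDegree N h × ∀ x → f x ≈ f r + (x - r) * h x
  monic-divide {f = f} (horner b g (one g≈1) f≈b+xg) r = (λ _ → 1#) , one (λ _ → refl) , λ x → begin
    f x                        ≈⟨ f≈b+xg x ⟩
    b + x * g x                ≈⟨ +-congˡ (*-cong (≈-∸+ x r) (g≈1 x)) ⟩
    b + ((x - r) + r) * 1#     ≈⟨ solve 4 (λ b d r u → (b ⊕ (d ⊕ r) ⊗ u) ⊜ (b ⊕ r ⊗ u ⊕ d ⊗ u))
                                    refl b (x - r) r 1# ⟩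
    b + r * 1# + (x - r) * 1#  ≈⟨ +-congʳ (+-congˡ (*-congˡ (g≈1 r))) ⟨
    b + r * g r + (x - r) * 1# ≈⟨ +-congʳ (f≈b+xg r) ⟨
    f r + (x - r) * 1#         ∎
  monic-divide {f = f} (horner b g mg@(horner _ _ _ _) f≈b+xg) r with monic-divide mg r
  ... | h , mh , g≈gr+[x-r]h =
    (λ x → g x + r * h x) , monic-+-degree< mg (degreeAtMost-scale r (monic⇒degreeAtMost mh)) , λ x → begin
      f x                                                  ≈⟨ f≈b+xg x ⟩
      b + x * g x
        ≈⟨ +-congˡ (*-cong (≈-∸+ x r) (g≈gr+[x-r]h x)) ⟩
      b + ((x - r) + r) * (g r + (x - r) * h x)
        ≈⟨ solve 5 (λ b d r gr hx → (b ⊕ (d ⊕ r) ⊗ (gr ⊕ d ⊗ hx))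
                                  ⊜ (b ⊕ r ⊗ gr ⊕ d ⊗ ((gr ⊕ d ⊗ hx) ⊕ r ⊗ hx)))
             refl b (x - r) r (g r) (h x) ⟩
      b + r * g r + (x - r) * ((g r + (x - r) * h x) + r * h x)
        ≈⟨ +-cong (sym (f≈b+xg r)) (*-congˡ (+-congʳ (sym (g≈gr+[x-r]h x)))) ⟩
      f r + (x - r) * (g x + r * h x)
        ∎

  x-r≉0 : ∀ {x r} → x ≉ r → x - r ≉ 0#
  x-r≉0 {x} {r} x≉r x-r≈0 = x≉r (begin
    x          ≈⟨ ≈-∸+ x r ⟩
    x - r + r  ≈⟨ +-congʳ x-r≈0 ⟩
    0# + r     ≈⟨ +-identityˡ r ⟩
    r          ∎)

  monic-roots≤degree : MonicOfDegree N f → (rs : List Carrier) → AllPairs _≉_ rs →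
                       All (λ r → f r ≈ 0#) rs → length rs ≤ N
  monic-roots≤degree mf [] _ _ = z≤n
  monic-roots≤degree (one f≈1) (r ∷ _) _ (fr≈0 ∷ _) = ⊥-elim (1≉0 (trans (sym (f≈1 r)) fr≈0))
  monic-roots≤degree {f = f} mf@(horner _ _ _ _) (r ∷ rs) (r≉rs ∷ distinct-rs) (fr≈0 ∷ frs≈0)
    with h , mh , f≈fr+[x-r]h ← monic-divide mf r =
    s≤s (monic-roots≤degree mh rs distinct-rs (roots-of-quotient rs r≉rs frs≈0))
    where
    roots-of-quotient : ∀ ys → All (r ≉_) ys → All (λ y → f y ≈ 0#) ys → All (λ y → h y ≈ 0#) ys
    roots-of-quotient []       []           []            = []
    roots-of-quotient (y ∷ ys) (r≉y ∷ r≉ys) (fy≈0 ∷ fys≈0) =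
      *-cancelˡ (x-r≉0 (r≉y ∘ sym)) (begin
        (y - r) * h y       ≈⟨ +-identityˡ _ ⟨
        0# + (y - r) * h y  ≈⟨ +-congʳ fr≈0 ⟨
        f r + (y - r) * h y ≈⟨ f≈fr+[x-r]h y ⟨
        f y                 ≈⟨ fy≈0 ⟩
        0#                  ≈⟨ zeroʳ _ ⟨
        (y - r) * 0#        ∎) ∷ roots-of-quotient ys r≉ys fys≈0

module CyclicUnits (E : FiniteField) where

  open FiniteField E
  open FieldArithmetic E
  open Enumeration E
  open Fermat E using (fermat)
  open RootBound E
  open Arithmetic
  open import Data.Nat as ℕ using (_≤_; _<_; z≤n; s≤s; NonZero; _^_)
  import Data.Nat.Properties as ℕ
  open import Data.Nat.Divisibility using (_∣_; _∤_; n∣m*n; m∣m*n; ∣-trans; 1∣_)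
  open import Data.Nat.GCD using (gcd; gcd-GCD; gcd[m,n]∣m; gcd[m,n]∣n; module Bézout)
  open import Data.Nat.Coprimality as Coprime using (Coprime; coprime-divisor)
  open import Data.Nat.Primality using (Prime)
  open import Data.Nat.Induction using (<-rec)
  open import Data.Nat.Tactic.RingSolver using (solve-∀)
  open import Data.Fin as Fin using (Fin)
  import Data.Fin.Properties as Fin
  open import Data.List using (tabulate; length)
  import Data.List.Properties as List
  import Data.List.Relation.Unary.All.Properties as All
  import Data.List.Relation.Unary.AllPairs.Properties as AllPairs
  open import Data.Product using (∃; _×_; _,_)
  open import Data.Empty using (⊥-elim)
  open import Function using (_∘_)
  open import Relation.Nullary using (yes; no; ¬?)
  open import Relation.Binary.PropositionalEquality as ≡ using (_≡_; _≢_)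
  open import Relation.Binary.Reasoning.Setoid setoid

  instance
    m-nonZero : NonZero m
    m-nonZero = Fin.nonZeroIndex (nonzero-index 1≉0)

  x^[1+D]-1-monic : ∀ D → MonicOfDegree (suc D) (λ x → pow x (suc D) - 1#)
  x^[1+D]-1-monic D = horner (- 1#) (λ x → pow x D) (x^D-monic D) (λ x → +-comm _ _)
    where
    x^D-monic : ∀ D → MonicOfDegree D (λ x → pow x D)
    x^D-monic zero    = one (λ _ → refl)
    x^D-monic (suc D) = horner 0# (λ x → pow x D) (x^D-monic D) (λ x → sym (+-identityˡ _))

  ∃pow≉1 : ∀ D → .{{_ : NonZero D}} → D < m → ∃ λ x → x ≉ 0# × pow x D ≉ 1#
  ∃pow≉1 (suc D) 1+D<m with Fin.any? (λ j → ¬? (pow (nonzero j) (suc D) ≈? 1#))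
  ... | yes (j , xʲ≉1) = nonzero j , nonzero-≉0 j , xʲ≉1
  ... | no all-roots = ⊥-elim (ℕ.<⇒≱ 1+D<m (≡.subst (_≤ suc D) (List.length-tabulate nonzero)
        (monic-roots≤degree (x^[1+D]-1-monic D) (tabulate nonzero)
          (AllPairs.tabulate⁺ (λ i≢j → i≢j ∘ nonzero-injective))
          (All.tabulate⁺ λ j → trans (+-congʳ (root j)) (-‿inverseʳ 1#)))))
    where
    root : ∀ j → pow (nonzero j) (suc D) ≈ 1#
    root j with pow (nonzero j) (suc D) ≈? 1#
    ... | yes xʲ≈1 = xʲ≈1
    ... | no xʲ≉1 = ⊥-elim (all-roots (j , xʲ≉1))

  HasOrder : Carrier → ℕ → Set
  HasOrder x N = pow x N ≈ 1# × (∀ i → pow x i ≈ 1# → N ∣ i)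

  pow≈1-+-cancelʳ : ∀ {x} g e → pow x e ≈ 1# → pow x (g ℕ.+ e) ≈ 1# → pow x g ≈ 1#
  pow≈1-+-cancelʳ {x} g e xᵉ≈1 xᵍ⁺ᵉ≈1 = begin
    pow x g              ≈⟨ *-identityʳ _ ⟨
    pow x g * 1#         ≈⟨ *-congˡ xᵉ≈1 ⟨
    pow x g * pow x e    ≈⟨ pow-+ x g e ⟨
    pow x (g ℕ.+ e)      ≈⟨ xᵍ⁺ᵉ≈1 ⟩
    1#                   ∎

  pow≈1-gcd : ∀ {x} a b → pow x a ≈ 1# → pow x b ≈ 1# → pow x (gcd a b) ≈ 1#
  pow≈1-gcd {x} a b xᵃ≈1 xᵇ≈1 with Bézout.identity (gcd-GCD a b)
  ... | Bézout.+- c d g+db≡ca = pow≈1-+-cancelʳ (gcd a b) (d ℕ.* b) (pow≈1-∣ b xᵇ≈1 (n∣m*n d))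
    (trans (reflexive (≡.cong (pow x) g+db≡ca)) (pow≈1-∣ a xᵃ≈1 (n∣m*n c)))
  ... | Bézout.-+ c d g+ca≡db = pow≈1-+-cancelʳ (gcd a b) (c ℕ.* a) (pow≈1-∣ a xᵃ≈1 (n∣m*n c))
    (trans (reflexive (≡.cong (pow x) g+ca≡db)) (pow≈1-∣ b xᵇ≈1 (n∣m*n d)))

  [xy]ⁱ≈1⇒xⁱˢ≈1 : ∀ {x y s} i → pow y s ≈ 1# → pow (x * y) i ≈ 1# → pow x (i ℕ.* s) ≈ 1#
  [xy]ⁱ≈1⇒xⁱˢ≈1 {x} {y} {s} i yˢ≈1 [xy]ⁱ≈1 = begin
    pow x (i ℕ.* s)                       ≈⟨ *-identityʳ _ ⟨
    pow x (i ℕ.* s) * 1#                  ≈⟨ *-congˡ (pow≈1-∣ s yˢ≈1 (n∣m*n i)) ⟨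
    pow x (i ℕ.* s) * pow y (i ℕ.* s)     ≈⟨ pow-distrib-* x y (i ℕ.* s) ⟨
    pow (x * y) (i ℕ.* s)                 ≈⟨ pow≈1-∣ i [xy]ⁱ≈1 (m∣m*n s) ⟩
    1#                                    ∎

  order-* : ∀ {x y r s} → HasOrder x r → HasOrder y s → Coprime r s → HasOrder (x * y) (r ℕ.* s)
  order-* {x} {y} {r} {s} (xʳ≈1 , r∣) (yˢ≈1 , s∣) r⊥s = [xy]ʳˢ≈1 , rs∣
    where
    [xy]ʳˢ≈1 : pow (x * y) (r ℕ.* s) ≈ 1#
    [xy]ʳˢ≈1 = begin
      pow (x * y) (r ℕ.* s)                 ≈⟨ pow-distrib-* x y (r ℕ.* s) ⟩
      pow x (r ℕ.* s) * pow y (r ℕ.* s)     ≈⟨ *-cong (pow≈1-∣ r xʳ≈1 (m∣m*n s)) (pow≈1-∣ s yˢ≈1 (n∣m*n r)) ⟩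
      1# * 1#                               ≈⟨ *-identityˡ 1# ⟩
      1#                                    ∎
    rs∣ : ∀ i → pow (x * y) i ≈ 1# → r ℕ.* s ∣ i
    rs∣ i [xy]ⁱ≈1 = coprime-∣-* r⊥s r∣i s∣i
      where
      r∣i : r ∣ i
      r∣i = coprime-divisor r⊥s (≡.subst (r ∣_) (ℕ.*-comm i s) (r∣ _ ([xy]ⁱ≈1⇒xⁱˢ≈1 i yˢ≈1 [xy]ⁱ≈1)))
      s∣i : s ∣ i
      s∣i = coprime-divisor (Coprime.sym r⊥s) (≡.subst (s ∣_) (ℕ.*-comm i r)
              (s∣ _ ([xy]ⁱ≈1⇒xⁱˢ≈1 i xʳ≈1 (trans (pow-cong i (*-comm y x)) [xy]ⁱ≈1))))

  prime-power-order : ∀ {y p} e → Prime p → pow y (p ^ suc e) ≈ 1# → pow y (p ^ e) ≉ 1# →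
                      HasOrder y (p ^ suc e)
  prime-power-order {y} {p} e pp y^pᵉ⁺¹≈1 y^pᵉ≉1 = y^pᵉ⁺¹≈1 , order∣
    where
    order∣ : ∀ i → pow y i ≈ 1# → p ^ suc e ∣ i
    order∣ i yⁱ≈1 with gcd i (p ^ suc e) ℕ.≟ p ^ suc e
    ... | yes g≡p^[1+e] = ≡.subst (_∣ i) g≡p^[1+e] (gcd[m,n]∣m i _)
    ... | no g≢p^[1+e] = ⊥-elim (y^pᵉ≉1 (pow≈1-∣ (gcd i (p ^ suc e)) (pow≈1-gcd i _ yⁱ≈1 y^pᵉ⁺¹≈1)
                                          (∣p^[1+e]⇒∣p^e e pp (gcd[m,n]∣n i _) g≢p^[1+e])))

  element-of-prime-power-order : ∀ {p} e c → Prime p → p ^ suc e ℕ.* c ≡ m →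
                                 ∃ λ y → y ≉ 0# × HasOrder y (p ^ suc e)
  element-of-prime-power-order {p} e c pp p^[1+e]c≡m = from-non-root (∃pow≉1 D D<m)
    where
    D : ℕ
    D = p ^ e ℕ.* c
    m≡D*p : m ≡ D ℕ.* p
    m≡D*p = ≡.trans (≡.sym p^[1+e]c≡m) (rearrange p (p ^ e) c)
      where
      rearrange : ∀ a b c → a ℕ.* b ℕ.* c ≡ b ℕ.* c ℕ.* a
      rearrange = solve-∀
    instance
      D-nonZero : NonZero D
      D-nonZero = ℕ.m*n≢0⇒m≢0 D {{≡.subst NonZero m≡D*p m-nonZero}}
    D<m : D ℕ.< m
    D<m = ≡.subst (D ℕ.<_) (≡.sym m≡D*p) (ℕ.m<m*n D p (prime>1 pp))
    from-non-root : (∃ λ x → x ≉ 0# × pow x D ≉ 1#) → ∃ λ y → y ≉ 0# × HasOrder y (p ^ suc e)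
    from-non-root (x , x≉0 , xᴰ≉1) =
      pow x c , pow-≉0 c x≉0 ,
      prime-power-order e pp y^pᵉ⁺¹≈1 (λ y^pᵉ≈1 → xᴰ≉1 (trans (x^[p^k*c] e) y^pᵉ≈1))
      where
      x^[p^k*c] : ∀ k → pow x (p ^ k ℕ.* c) ≈ pow (pow x c) (p ^ k)
      x^[p^k*c] k = trans (reflexive (≡.cong (pow x) (ℕ.*-comm (p ^ k) c))) (pow-* x c (p ^ k))
      y^pᵉ⁺¹≈1 : pow (pow x c) (p ^ suc e) ≈ 1#
      y^pᵉ⁺¹≈1 =
        trans (sym (x^[p^k*c] (suc e))) (trans (reflexive (≡.cong (pow x) p^[1+e]c≡m)) (fermat x≉0))

  ElementOfOrder : ℕ → Set
  ElementOfOrder N = ∃ λ x → x ≉ 0# × HasOrder x N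

  private
    extend-by-prime-power : ∀ {p e N c} → Prime p → p ∤ N → .{{_ : NonZero N}} →
                            p ^ suc e ℕ.* N ℕ.* c ≡ m → ElementOfOrder N → ElementOfOrder (p ^ suc e ℕ.* N)
    extend-by-prime-power {p} {e} {N} {c} pp p∤N p^[1+e]Nc≡m (x , x≉0 , x-order) =
      multiply (element-of-prime-power-order e (N ℕ.* c) pp
                 (≡.trans (≡.sym (ℕ.*-assoc (p ^ suc e) N c)) p^[1+e]Nc≡m))
      where
      multiply : ElementOfOrder (p ^ suc e) → ElementOfOrder (p ^ suc e ℕ.* N)
      multiply (y , y≉0 , y-order) =
        y * x , *-≉0 y≉0 x≉0 , order-* y-order x-order (prime^-coprime (suc e) pp p∤N)

    Goal : ℕ → Set
    Goal N = ∀ c → N ℕ.* c ≡ m → Coprime N c → ElementOfOrder N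

    split-step : ∀ {p} e N′ → Prime p → p ∤ N′ → (∀ {K} → K < p ^ suc e ℕ.* N′ → Goal K) →
                 Goal (p ^ suc e ℕ.* N′)
    split-step {p} e N′ pp p∤N′ rec c Nc≡m N⊥c =
      extend-by-prime-power {e = e} pp p∤N′ Nc≡m
        (rec N′<N (p ^ suc e ℕ.* c) N′[p^[1+e]c]≡m N′⊥p^[1+e]c)
      where
      instance
        N′-nonZero : NonZero N′
        N′-nonZero =
          ℕ.m*n≢0⇒n≢0 (p ^ suc e) {{ℕ.m*n≢0⇒m≢0 _ {{≡.subst NonZero (≡.sym Nc≡m) m-nonZero}}}}
      N′<N : N′ < p ^ suc e ℕ.* N′
      N′<N =
        ≡.subst (N′ <_) (ℕ.*-comm N′ (p ^ suc e)) (ℕ.m<m*n N′ (p ^ suc e) (prime^[1+e]>1 e pp))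
      N′[p^[1+e]c]≡m : N′ ℕ.* (p ^ suc e ℕ.* c) ≡ m
      N′[p^[1+e]c]≡m = ≡.trans (rearrange N′ (p ^ suc e) c) Nc≡m
        where
        rearrange : ∀ a b c → a ℕ.* (b ℕ.* c) ≡ b ℕ.* a ℕ.* c
        rearrange = solve-∀
      N′⊥p^[1+e]c : Coprime N′ (p ^ suc e ℕ.* c)
      N′⊥p^[1+e]c = Coprime.sym (coprime-*ˡ (prime^-coprime (suc e) pp p∤N′)
        λ (d∣c , d∣N′) → N⊥c (∣-trans d∣N′ (n∣m*n (p ^ suc e)) , d∣c))

    composite-step : ∀ N → 1 < N → (∀ {K} → K < N → Goal K) → Goal N
    composite-step N 1<N rec with p , pp , p∣N ← prime-factor 1<N
      with e , N′ , ≡.refl , p∤N′ ← prime-power-split pp {{ℕ.>-nonZero (ℕ.<-trans ℕ.z<s 1<N)}} p∣N =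
      split-step e N′ pp p∤N′ rec

  element-of-order : ∀ N c → N ℕ.* c ≡ m → Coprime N c → ElementOfOrder N
  element-of-order = <-rec Goal step
    where
    step : ∀ N → (∀ {K} → K < N → Goal K) → Goal N
    step zero             _   c 0≡m _ = ⊥-elim (ℕ.≢-nonZero⁻¹ m (≡.sym 0≡m))
    step (suc zero)       _   c _   _ = 1# , 1≉0 , *-identityʳ 1# , λ i _ → 1∣ i
    step (suc (suc n)) rec = composite-step (suc (suc n)) (s≤s (s≤s z≤n)) rec

  generator : ElementOfOrder m
  generator = element-of-order m 1 (ℕ.*-identityʳ m) (Coprime.sym (Coprime.1-coprimeTo m))

module DiscreteLog (E : FiniteField) where

  open FiniteField E
  open FieldArithmetic E
  open Enumeration E
  open CyclicUnits E using (m-nonZero; generator)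
  open Arithmetic using (injective<-by-≤; ∣∸⇒≡)
  open Sums using (injective⇒surjective)
  open import Data.Nat as ℕ using (ℕ; _≤_; _<_; _%_; _/_)
  import Data.Nat.Properties as ℕ
  open import Data.Nat.DivMod using (m≡m%n+[m/n]*n; m%n<n)
  open import Data.Nat.Divisibility using (_∣_; n∣m*n; ∣n∣m%n⇒∣m; %-presˡ-∣)
  open import Data.Fin as Fin using (Fin; toℕ)
  import Data.Fin.Properties as Fin
  open import Data.Product using (∃; _,_; proj₁; proj₂)
  open import Relation.Binary.PropositionalEquality as ≡ using (_≡_)
  open import Relation.Binary.Reasoning.Setoid setoid

  opaque
    γ : Carrier
    γ = proj₁ generator

    γ≉0 : γ ≉ 0#
    γ≉0 = proj₁ (proj₂ generator)

    γ^m≈1 : pow γ m ≈ 1#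
    γ^m≈1 = proj₁ (proj₂ (proj₂ generator))

    γ^i≈1⇒m∣i : ∀ i → pow γ i ≈ 1# → m ∣ i
    γ^i≈1⇒m∣i = proj₂ (proj₂ (proj₂ generator))

  γ^-≉0 : ∀ i → pow γ i ≉ 0#
  γ^-≉0 i = pow-≉0 i γ≉0

  γ^-% : ∀ a → pow γ a ≈ pow γ (a % m)
  γ^-% a = begin
    pow γ a                                 ≡⟨ ≡.cong (pow γ) (m≡m%n+[m/n]*n a m) ⟩
    pow γ (a % m ℕ.+ a / m ℕ.* m)           ≈⟨ pow-+ γ (a % m) _ ⟩
    pow γ (a % m) * pow γ (a / m ℕ.* m)     ≈⟨ *-congˡ (pow≈1-∣ m γ^m≈1 (n∣m*n (a / m))) ⟩
    pow γ (a % m) * 1#                      ≈⟨ *-identityʳ _ ⟩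
    pow γ (a % m)                           ∎

  γ^-injective : ∀ {i j} → i < m → j < m → pow γ i ≈ pow γ j → i ≡ j
  γ^-injective = injective<-by-≤ {_≈_ = _≈_} sym (pow γ) λ {i} {j} i≤j j<m γⁱ≈γʲ →
    ∣∸⇒≡ (γ^i≈1⇒m∣i (j ℕ.∸ i) (pow-cancel i (j ℕ.∸ i) γ≉0
      (trans (reflexive (≡.cong (pow γ) (ℕ.m+[n∸m]≡n i≤j))) (sym γⁱ≈γʲ)))) i≤j j<m

  γ^-≈⇒%≡ : ∀ a b → pow γ a ≈ pow γ b → a % m ≡ b % m
  γ^-≈⇒%≡ a b γᵃ≈γᵇ =
    γ^-injective (m%n<n a m) (m%n<n b m) (trans (sym (γ^-% a)) (trans γᵃ≈γᵇ (γ^-% b)))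

  γ^-≈-∣ : ∀ {d a b} → d ∣ m → pow γ a ≈ pow γ b → d ∣ a → d ∣ b
  γ^-≈-∣ {d} {a} {b} d∣m γᵃ≈γᵇ d∣a =
    ∣n∣m%n⇒∣m d∣m (≡.subst (d ∣_) (γ^-≈⇒%≡ a b γᵃ≈γᵇ) (%-presˡ-∣ d∣a d∣m))

  private
    γ^-index : Fin m → Fin m
    γ^-index j = nonzero-index (γ^-≉0 (toℕ j))

    γ^-index-injective : ∀ {i j} → γ^-index i ≡ γ^-index j → i ≡ j
    γ^-index-injective {i} {j} eq = Fin.toℕ-injective (γ^-injective (Fin.toℕ<n i) (Fin.toℕ<n j) (begin
      pow γ (toℕ i)          ≈⟨ nonzero-index-≈ (γ^-≉0 (toℕ i)) ⟨
      nonzero (γ^-index i)   ≡⟨ ≡.cong nonzero eq ⟩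
      nonzero (γ^-index j)   ≈⟨ nonzero-index-≈ (γ^-≉0 (toℕ j)) ⟩
      pow γ (toℕ j)          ∎))

  discrete-log : ∀ {x} → x ≉ 0# → ∃ λ j → pow γ j ≈ x
  discrete-log {x} x≉0 with j , γʲ-index≡x-index ←
    injective⇒surjective γ^-index ℕ.≤-refl γ^-index-injective (nonzero-index x≉0) =
    toℕ j , (begin
      pow γ (toℕ j)                 ≈⟨ nonzero-index-≈ (γ^-≉0 (toℕ j)) ⟨
      nonzero (γ^-index j)          ≡⟨ ≡.cong nonzero γʲ-index≡x-index ⟩
      nonzero (nonzero-index x≉0)   ≈⟨ nonzero-index-≈ x≉0 ⟩
      x                             ∎)

module Twisting (E : FiniteField) (q : ℕ) where

  open FiniteField E
  open FieldArithmetic E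
  open import Data.List using (List; []; _∷_; _++_; [_]; replicate; length)
  import Data.List.Properties as List
  open import Data.List.Relation.Binary.Equality.Setoid setoid
    using (_≋_; ≋-refl; ≋-reflexive; ≋-sym; ≋-trans; ≋-setoid; []; _∷_; ++⁺)
  open import Data.List.Relation.Unary.All using (All; []; _∷_)
  open import Data.Unit using (tt)
  open import Data.Product using (_,_)
  open import Data.Empty using (⊥-elim)
  open import Relation.Nullary using (¬_)
  open import Relation.Binary.PropositionalEquality as ≡ using (_≡_)
  import Relation.Binary.Reasoning.Setoid as Reasoning
  import Data.List.Relation.Unary.All.Properties as All

  infixl 6 _⊕_
  infixl 7 _⊛_
  infixr 8 _⊙_
  infix 4 _≃_

  _⊕_ _⊛_ : List Carrier → List Carrier → List Carrier
  _⊕_ = _+ₚ_ E q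
  _⊛_ = _*ₚ_ E q

  _⊙_ : Carrier → List Carrier → List Carrier
  _⊙_ = scale E q

  _≃_ : List Carrier → List Carrier → Set
  _≃_ = _≈ₚ_ E q

  σ : List Carrier → Carrier → Carrier
  σ = σapply E q

  InF′ : Carrier → Set
  InF′ = InF E q

  private variable
    a c l : Carrier
    A B X Y Z : List Carrier

  ⊕-cong : A ≋ X → B ≋ Y → A ⊕ B ≋ X ⊕ Y
  ⊕-cong []       B≋Y      = B≋Y
  ⊕-cong (a≈ ∷ A≋) []       = a≈ ∷ A≋
  ⊕-cong (a≈ ∷ A≋) (b≈ ∷ B≋) = +-cong a≈ b≈ ∷ ⊕-cong A≋ B≋

  ⊙-cong : c ≈ l → A ≋ X → c ⊙ A ≋ l ⊙ X
  ⊙-cong c≈l []        = []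
  ⊙-cong c≈l (a≈ ∷ A≋) = *-cong c≈l a≈ ∷ ⊙-cong c≈l A≋

  ⊛-cong : A ≋ X → B ≋ Y → A ⊛ B ≋ X ⊛ Y
  ⊛-cong []        B≋Y = []
  ⊛-cong (a≈ ∷ A≋) B≋Y = ⊕-cong (⊙-cong a≈ B≋Y) (refl ∷ ⊛-cong A≋ B≋Y)

  ⊙-distrib-⊕ : ∀ c X Y → c ⊙ (X ⊕ Y) ≋ c ⊙ X ⊕ c ⊙ Y
  ⊙-distrib-⊕ c []      Y       = ≋-refl
  ⊙-distrib-⊕ c (x ∷ X) []      = ≋-refl
  ⊙-distrib-⊕ c (x ∷ X) (y ∷ Y) = distribˡ c x y ∷ ⊙-distrib-⊕ c X Y

  ⊙-assoc : ∀ c a X → c ⊙ (a ⊙ X) ≋ (c * a) ⊙ X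
  ⊙-assoc c a []      = []
  ⊙-assoc c a (x ∷ X) = sym (*-assoc c a x) ∷ ⊙-assoc c a X

  ⊙-comm : ∀ c a X → c ⊙ (a ⊙ X) ≋ a ⊙ (c ⊙ X)
  ⊙-comm c a X = ≋-trans (⊙-assoc c a X) (≋-trans (⊙-cong (*-comm c a) ≋-refl) (≋-sym (⊙-assoc a c X)))

  ⊙-identity : ∀ X → c ≈ 1# → c ⊙ X ≋ X
  ⊙-identity []      c≈1 = []
  ⊙-identity (x ∷ X) c≈1 = trans (*-congʳ c≈1) (*-identityˡ x) ∷ ⊙-identity X c≈1

  ⊙-⊛ˡ : ∀ c A B → c ⊙ (A ⊛ B) ≋ c ⊙ A ⊛ B
  ⊙-⊛ˡ c []      B = []
  ⊙-⊛ˡ c (a ∷ A) B = ≋-trans (⊙-distrib-⊕ c (a ⊙ B) (0# ∷ A ⊛ B))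
    (⊕-cong (⊙-assoc c a B) (zeroʳ c ∷ ⊙-⊛ˡ c A B))

  ⊙-⊛ʳ : ∀ c A B → c ⊙ (A ⊛ B) ≋ A ⊛ c ⊙ B
  ⊙-⊛ʳ c []      B = []
  ⊙-⊛ʳ c (a ∷ A) B = ≋-trans (⊙-distrib-⊕ c (a ⊙ B) (0# ∷ A ⊛ B))
    (⊕-cong (⊙-comm c a B) (zeroʳ c ∷ ⊙-⊛ʳ c A B))

  twist : Carrier → List Carrier → List Carrier
  twist c []       = []
  twist c (a ∷ A) = a ∷ c ⊙ twist c A

  twist-⊕ : ∀ c X Y → twist c (X ⊕ Y) ≋ twist c X ⊕ twist c Y
  twist-⊕ c []      Y       = ≋-refl
  twist-⊕ c (x ∷ X) []      = ≋-refl
  twist-⊕ c (x ∷ X) (y ∷ Y) =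
    refl ∷ ≋-trans (⊙-cong refl (twist-⊕ c X Y)) (⊙-distrib-⊕ c (twist c X) (twist c Y))

  twist-⊙ : ∀ c a Y → twist c (a ⊙ Y) ≋ a ⊙ twist c Y
  twist-⊙ c a []      = []
  twist-⊙ c a (y ∷ Y) = refl ∷ ≋-trans (⊙-cong refl (twist-⊙ c a Y)) (⊙-comm c a (twist c Y))

  twist-⊛ : ∀ c A B → twist c (A ⊛ B) ≋ twist c A ⊛ twist c B
  twist-⊛ c []      B = []
  twist-⊛ c (a ∷ A) B = ≋-trans (twist-⊕ c (a ⊙ B) (0# ∷ A ⊛ B))
    (⊕-cong (twist-⊙ c a B)
            (refl ∷ ≋-trans (⊙-cong refl (twist-⊛ c A B)) (⊙-⊛ˡ c (twist c A) (twist c B))))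

  ≋⇒≃ : X ≋ Y → X ≃ Y
  ≋⇒≃ []        = tt
  ≋⇒≃ (x≈ ∷ X≋) = x≈ , ≋⇒≃ X≋

  ≃-trans : ∀ X Y Z → X ≃ Y → Y ≃ Z → X ≃ Z
  ≃-trans []      []      Z       _          Y≃Z        = Y≃Z
  ≃-trans []      (y ∷ Y) []      _          _          = tt
  ≃-trans []      (y ∷ Y) (z ∷ Z) (y≈0 , ≃Y) (y≈z , Y≃) = trans (sym y≈z) y≈0 , ≃-trans [] Y Z ≃Y Y≃
  ≃-trans (x ∷ X) []      []      X≃         _          = X≃
  ≃-trans (x ∷ X) []      (z ∷ Z) (x≈0 , X≃) (z≈0 , ≃Z) = trans x≈0 (sym z≈0) , ≃-trans X [] Z X≃ ≃Z
  ≃-trans (x ∷ X) (y ∷ Y) []      (x≈y , X≃) (y≈0 , Y≃) = trans x≈y y≈0 , ≃-trans X Y [] X≃ Y≃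
  ≃-trans (x ∷ X) (y ∷ Y) (z ∷ Z) (x≈y , X≃) (y≈z , Y≃) = trans x≈y y≈z , ≃-trans X Y Z X≃ Y≃

  ≃-sym : ∀ X Y → X ≃ Y → Y ≃ X
  ≃-sym []      []      _           = tt
  ≃-sym []      (y ∷ Y) (y≈0 , ≃Y)  = y≈0 , ≃-sym [] Y ≃Y
  ≃-sym (x ∷ X) []      (x≈0 , X≃)  = x≈0 , ≃-sym X [] X≃
  ≃-sym (x ∷ X) (y ∷ Y) (x≈y , X≃Y) = sym x≈y , ≃-sym X Y X≃Y

  ⊙-≃[] : ∀ c X → X ≃ [] → c ⊙ X ≃ []
  ⊙-≃[] c []      _          = tt
  ⊙-≃[] c (x ∷ X) (x≈0 , X≃) = trans (*-congˡ x≈0) (zeroʳ c) , ⊙-≃[] c X X≃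

  twist-≃[] : ∀ c X → X ≃ [] → twist c X ≃ []
  twist-≃[] c []      _          = tt
  twist-≃[] c (x ∷ X) (x≈0 , X≃) = x≈0 , ⊙-≃[] c (twist c X) (twist-≃[] c X X≃)

  ⊙-≃ : ∀ c X Y → X ≃ Y → c ⊙ X ≃ c ⊙ Y
  ⊙-≃ c []      []      _           = tt
  ⊙-≃ c []      (y ∷ Y) []≃         =
    ≃-sym (c ⊙ (y ∷ Y)) [] (⊙-≃[] c (y ∷ Y) (≃-sym [] (y ∷ Y) []≃))
  ⊙-≃ c (x ∷ X) []      ≃[]         = ⊙-≃[] c (x ∷ X) ≃[]
  ⊙-≃ c (x ∷ X) (y ∷ Y) (x≈y , X≃Y) = *-congˡ x≈y , ⊙-≃ c X Y X≃Y

  twist-≃ : ∀ c X Y → X ≃ Y → twist c X ≃ twist c Y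
  twist-≃ c []      []      _           = tt
  twist-≃ c []      (y ∷ Y) []≃         =
    ≃-sym (twist c (y ∷ Y)) [] (twist-≃[] c (y ∷ Y) (≃-sym [] (y ∷ Y) []≃))
  twist-≃ c (x ∷ X) []      ≃[]         = twist-≃[] c (x ∷ X) ≃[]
  twist-≃ c (x ∷ X) (y ∷ Y) (x≈y , X≃Y) = x≈y , ⊙-≃ c (twist c X) (twist c Y) (twist-≃ c X Y X≃Y)

  ⊙-monomial : ∀ c k y → c ⊙ (replicate k 0# ++ [ y ]) ≋ replicate k 0# ++ [ c * y ]
  ⊙-monomial c zero    y = refl ∷ []
  ⊙-monomial c (suc k) y = zeroʳ c ∷ ⊙-monomial c k y

  ⊙-twist-monomial : ∀ c k y →
                     c ⊙ twist c (replicate k 0# ++ [ y ]) ≋ replicate k 0# ++ [ pow c (suc k) * y ]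
  ⊙-twist-monomial c zero    y = sym (*-congʳ (*-identityʳ c)) ∷ []
  ⊙-twist-monomial c (suc k) y = zeroʳ c ∷ ≋-trans (⊙-cong refl (⊙-twist-monomial c k y))
    (≋-trans (⊙-monomial c k (pow c (suc k) * y)) (++⁺ ≋-refl (sym (*-assoc c (pow c (suc k)) y) ∷ [])))

  twist-xⁿ-1 : ∀ n′ → pow c (suc n′) ≈ 1# → twist c (xⁿ-1 E q (suc n′)) ≃ xⁿ-1 E q (suc n′)
  twist-xⁿ-1 {c} n′ cⁿ≈1 = ≋⇒≃ (refl ∷ ≋-trans (⊙-twist-monomial c n′ 1#)
    (++⁺ ≋-refl (trans (*-identityʳ _) cⁿ≈1 ∷ [])))

  σ-cong : ∀ H {x y} → x ≈ y → σ H x ≈ σ H y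
  σ-cong []      x≈y = refl
  σ-cong (a ∷ H) x≈y = +-cong (*-congˡ x≈y) (σ-cong H (pow-cong q x≈y))

  σ-≋ : ∀ {H K} x → H ≋ K → σ H x ≈ σ K x
  σ-≋ x []        = refl
  σ-≋ x (a≈ ∷ H≋) = +-cong (*-congʳ a≈) (σ-≋ _ H≋)

  σ-⊙ : ∀ c K y → σ (c ⊙ K) y ≈ c * σ K y
  σ-⊙ c []      y = sym (zeroʳ c)
  σ-⊙ c (a ∷ K) y = trans (+-cong (*-assoc c a y) (σ-⊙ c K (pow y q))) (sym (distribˡ c _ _))

  *-swapˡ : ∀ x y z → x * (y * z) ≈ y * (x * z)
  *-swapˡ x y z = trans (sym (*-assoc x y z)) (trans (*-congʳ (*-comm x y)) (*-assoc y x z))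

  σ-linear : InF′ l → ∀ K y → σ K (l * y) ≈ l * σ K y
  σ-linear l∈F []      y = sym (zeroʳ _)
  σ-linear {l} l∈F (a ∷ K) y = begin
    a * (l * y) + σ K (pow (l * y) q)
      ≈⟨ +-cong (*-swapˡ a l y) (σ-cong K (trans (pow-distrib-* l y q) (*-congʳ l∈F))) ⟩
    l * (a * y) + σ K (l * pow y q)       ≈⟨ +-congˡ (σ-linear l∈F K (pow y q)) ⟩
    l * (a * y) + l * σ K (pow y q)       ≈⟨ distribˡ l _ _ ⟨
    l * (a * y + σ K (pow y q))           ∎
    where open Reasoning setoid

  -- (u x)^q = u (c x^q), so evaluating H^σ at u x amounts to evaluating H(c x)^σ at x.
  σ-twist : ∀ {u} → InF′ c → pow u q ≈ u * c → ∀ H x → σ H (u * x) ≈ u * σ (twist c H) x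
  σ-twist c∈F uq≈uc [] x = sym (zeroʳ _)
  σ-twist {c} {u} c∈F uq≈uc (a ∷ H) x = begin
    a * (u * x) + σ H (pow (u * x) q)
      ≈⟨ +-cong (*-swapˡ a u x) (σ-cong H (trans (pow-distrib-* u x q) (trans (*-congʳ uq≈uc) (*-assoc u c _)))) ⟩
    u * (a * x) + σ H (u * (c * pow x q))        ≈⟨ +-congˡ (σ-twist c∈F uq≈uc H (c * pow x q)) ⟩
    u * (a * x) + u * σ (twist c H) (c * pow x q) ≈⟨ +-congˡ (*-congˡ (σ-linear c∈F (twist c H) (pow x q))) ⟩
    u * (a * x) + u * (c * σ (twist c H) (pow x q)) ≈⟨ +-congˡ (*-congˡ (σ-⊙ c (twist c H) (pow x q))) ⟨
    u * (a * x) + u * σ (c ⊙ twist c H) (pow x q) ≈⟨ distribˡ u _ _ ⟨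
    u * (a * x + σ (c ⊙ twist c H) (pow x q))    ∎
    where open Reasoning setoid

  InF-* : InF′ a → InF′ c → InF′ (a * c)
  InF-* {a} {c} a∈F c∈F = trans (pow-distrib-* a c q) (*-cong a∈F c∈F)

  InF-⁻¹ : a ≉ 0# → InF′ a → InF′ (a ⁻¹)
  InF-⁻¹ a≉0 a∈F = trans (pow-⁻¹ q a≉0) (⁻¹-cong (pow-≉0 q a≉0) a∈F)

  InF-pow : ∀ k → InF′ a → InF′ (pow a k)
  InF-pow zero    a∈F = pow-1# q
  InF-pow (suc k) a∈F = InF-* a∈F (InF-pow k a∈F)

  All-⊙ : ∀ X → InF′ c → All InF′ X → All InF′ (c ⊙ X)
  All-⊙ []      c∈F []           = []
  All-⊙ (x ∷ X) c∈F (x∈F ∷ X∈F) = InF-* c∈F x∈F ∷ All-⊙ X c∈F X∈F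

  All-twist : ∀ X → InF′ c → All InF′ X → All InF′ (twist c X)
  All-twist []      c∈F []          = []
  All-twist (x ∷ X) c∈F (x∈F ∷ X∈F) = x∈F ∷ All-⊙ (twist _ X) c∈F (All-twist X c∈F X∈F)

  twist-snoc : ∀ c as y → twist c (as ++ [ y ]) ≋ twist c as ++ [ pow c (length as) * y ]
  twist-snoc c []       y = sym (*-identityˡ y) ∷ []
  twist-snoc c (a ∷ as) y = refl ∷ ≋-trans (⊙-cong refl (twist-snoc c as y))
    (≋-trans (≋-reflexive (List.map-++ (c *_) (twist c as) _)) (++⁺ ≋-refl (sym (*-assoc c _ y) ∷ [])))

  -- c^(-deg H) H(c x) for H = as ++ [ 1# ], with its leading coefficient written as 1# so that it is Monic.
  monicTwist : Carrier → List Carrier → List Carrier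
  monicTwist c as = (pow c (length as)) ⁻¹ ⊙ twist c as ++ [ 1# ]

  monicTwist-≋ : ∀ as → c ≉ 0# → monicTwist c as ≋ (pow c (length as)) ⁻¹ ⊙ twist c (as ++ [ 1# ])
  monicTwist-≋ {c} as c≉0 = ≋-sym (≋-trans (⊙-cong refl (twist-snoc c as 1#))
    (≋-trans (≋-reflexive (List.map-++ _ (twist c as) _)) (++⁺ ≋-refl (ℓ⁻¹ℓ≈1 ∷ []))))
    where
    ℓ⁻¹ℓ≈1 : (pow c (length as)) ⁻¹ * (pow c (length as) * 1#) ≈ 1#
    ℓ⁻¹ℓ≈1 = trans (*-congˡ (*-identityʳ _)) (inverseˡ (pow-≉0 (length as) c≉0))

  monicTwist-∈F : ∀ as → c ≉ 0# → InF′ c → All InF′ as → All InF′ (monicTwist c as)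
  monicTwist-∈F {c} as c≉0 c∈F as∈F = All.++⁺ (All-⊙ _ ℓ⁻¹∈F (All-twist as c∈F as∈F)) (pow-1# q ∷ [])
    where
    ℓ⁻¹∈F : InF′ ((pow c (length as)) ⁻¹)
    ℓ⁻¹∈F = InF-⁻¹ (pow-≉0 (length as) c≉0) (InF-pow (length as) c∈F)

  monicTwist-⊛ : ∀ as K → c ≉ 0# →
                 monicTwist c as ⊛ (pow c (length as) ⊙ twist c K) ≋ twist c ((as ++ [ 1# ]) ⊛ K)
  monicTwist-⊛ {c} as K c≉0 = begin
    monicTwist c as ⊛ ℓ ⊙ T[K]             ≈⟨ ⊛-cong (monicTwist-≋ as c≉0) ≋-refl ⟩
    ℓ ⁻¹ ⊙ T[H] ⊛ ℓ ⊙ T[K]                ≈⟨ ⊙-⊛ˡ (ℓ ⁻¹) T[H] (ℓ ⊙ T[K]) ⟨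
    ℓ ⁻¹ ⊙ (T[H] ⊛ ℓ ⊙ T[K])              ≈⟨ ⊙-cong refl (⊙-⊛ʳ ℓ T[H] T[K]) ⟨
    ℓ ⁻¹ ⊙ (ℓ ⊙ (T[H] ⊛ T[K]))            ≈⟨ ⊙-assoc (ℓ ⁻¹) ℓ _ ⟩
    (ℓ ⁻¹ * ℓ) ⊙ (T[H] ⊛ T[K])            ≈⟨ ⊙-identity _ (inverseˡ (pow-≉0 (length as) c≉0)) ⟩
    T[H] ⊛ T[K]                           ≈⟨ twist-⊛ c (as ++ [ 1# ]) K ⟨
    twist c ((as ++ [ 1# ]) ⊛ K)          ∎
    where
    open Reasoning ≋-setoid
    ℓ : Carrier
    ℓ = pow c (length as)
    T[H] T[K] : List Carrier
    T[H] = twist c (as ++ [ 1# ])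
    T[K] = twist c K

  σ-monicTwist : ∀ {u} as → c ≉ 0# → InF′ c → pow u q ≈ u * c → ∀ v →
                 u * σ (monicTwist c as) (pow c (length as) * v) ≈ σ (as ++ [ 1# ]) (u * v)
  σ-monicTwist {c} {u} as c≉0 c∈F uq≈uc v = begin
    u * σ (monicTwist c as) (ℓ * v)        ≈⟨ *-congˡ (σ-≋ _ (monicTwist-≋ as c≉0)) ⟩
    u * σ (ℓ ⁻¹ ⊙ twist c H) (ℓ * v)       ≈⟨ *-congˡ (σ-⊙ (ℓ ⁻¹) (twist c H) _) ⟩
    u * (ℓ ⁻¹ * σ (twist c H) (ℓ * v))
      ≈⟨ *-congˡ (*-congˡ (σ-linear (InF-pow (length as) c∈F) (twist c H) v)) ⟩
    u * (ℓ ⁻¹ * (ℓ * σ (twist c H) v))     ≈⟨ *-congˡ (⁻¹-cancelˡ _ (pow-≉0 (length as) c≉0)) ⟩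
    u * σ (twist c H) v                    ≈⟨ σ-twist c∈F uq≈uc H v ⟨
    σ H (u * v)                            ∎
    where
    open Reasoning setoid
    ℓ : Carrier
    ℓ = pow c (length as)
    H : List Carrier
    H = as ++ [ 1# ]

  ∷-++[1]≄[1] : ∀ x xs → ¬ (x ∷ xs ++ [ 1# ] ≃ [ 1# ])
  ∷-++[1]≄[1] x xs (_ , xs++[1]≃[]) = ++[1]≄[] xs xs++[1]≃[]
    where
    ++[1]≄[] : ∀ xs → ¬ (xs ++ [ 1# ] ≃ [])
    ++[1]≄[] []       (1≈0 , _)     = 1≉0 1≈0
    ++[1]≄[] (x ∷ xs) (_ , xs++[1]≃) = ++[1]≄[] xs xs++[1]≃

  -- If u w = H^σ(v) for a monic divisor H ≠ 1 of g, then w = H′^σ(c^deg u⁻¹ v) for H′ = monicTwist c as.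
  gfree-* : ∀ {g u c w} → twist c g ≃ g → u ≉ 0# → c ≉ 0# → InF′ c → pow u q ≈ u * c →
            GFree E q g w → GFree E q g (u * w)
  gfree-* _ _ _ _ _ _ H v _ ([] , ≡.refl) _ _ = refl , tt
  gfree-* {g} {u} {c} {w} twist-g≃g u≉0 c≉0 c∈F uq≈uc w-free H v H∈F (as@(_ ∷ _) , ≡.refl)
    (K , K∈F , HK≃g) σHv≈uw =
    ⊥-elim (∷-++[1]≄[1] _ _ (w-free H′ (ℓ * v′) H′∈F H′-monic (K′ , K′∈F , H′K′≃g) σH′v′≈w))
    where
    ℓ v′ : Carrier
    ℓ = pow c (length as)
    v′ = u ⁻¹ * v
    H′ K′ : List Carrier
    H′ = monicTwist c as
    K′ = ℓ ⊙ twist c K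
    H′-monic : Monic E q H′
    H′-monic = ℓ ⁻¹ ⊙ twist c as , ≡.refl
    H′∈F : All InF′ H′
    H′∈F = monicTwist-∈F as c≉0 c∈F (All.++⁻ˡ as H∈F)
    K′∈F : All InF′ K′
    K′∈F = All-⊙ _ (InF-pow (length as) c∈F) (All-twist K c∈F K∈F)
    H′K′≃g : H′ ⊛ K′ ≃ g
    H′K′≃g = ≃-trans _ _ g (≋⇒≃ (monicTwist-⊛ as K c≉0)) (≃-trans _ _ g (twist-≃ c _ g HK≃g) twist-g≃g)
    uv′≈v : u * v′ ≈ v
    uv′≈v = trans (sym (*-assoc u (u ⁻¹) v)) (trans (*-congʳ (inverseʳ u u≉0)) (*-identityˡ v))
    σH′v′≈w : σ H′ (ℓ * v′) ≈ w
    σH′v′≈w = *-cancelˡ u≉0 (trans (σ-monicTwist as c≉0 c∈F uq≈uc v′) (trans (σ-cong H uv′≈v) σHv≈uw))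

module Multipliers (E : FiniteField) (q′ n′ : ℕ) where

  open FiniteField E
  open FieldArithmetic E
  open Twisting E (suc q′) using (gfree-*; twist-xⁿ-1; InF-⁻¹)
  open import Data.List using (List)
  open import Data.Product using (_×_; _,_)

  private
    q n : ℕ
    q = suc q′
    n = suc n′

  g : List Carrier
  g = xⁿ-1 E q n

  -- With c = u^(q-1), u^q = u c holds definitionally; gfree-* needs c ∈ F and cⁿ = 1.
  Multiplier : Carrier → Set
  Multiplier u = u ≉ 0# × InF E q (pow u q′) × pow (pow u q′) n ≈ 1#

  private variable
    u w : Carrier

  multiplier-⁻¹ : Multiplier u → Multiplier (u ⁻¹)
  multiplier-⁻¹ {u} (u≉0 , c∈F , cⁿ≈1) =
    ⁻¹-≉0 u≉0 ,
    InF-resp (sym (pow-⁻¹ q′ u≉0)) (InF-⁻¹ (pow-≉0 q′ u≉0) c∈F) ,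
    trans (pow-cong n (pow-⁻¹ q′ u≉0))
      (trans (pow-⁻¹ n (pow-≉0 q′ u≉0)) (trans (⁻¹-cong (pow-≉0 n (pow-≉0 q′ u≉0)) cⁿ≈1) 1⁻¹≈1))
    where
    InF-resp : ∀ {x y} → x ≈ y → InF E q x → InF E q y
    InF-resp x≈y x∈F = trans (pow-cong q (sym x≈y)) (trans x∈F x≈y)

  gfree-multiplier : Multiplier u → GFree E q g w → GFree E q g (u * w)
  gfree-multiplier {u} (u≉0 , c∈F , cⁿ≈1) = gfree-* (twist-xⁿ-1 n′ cⁿ≈1) u≉0 (pow-≉0 q′ u≉0) c∈F refl

  GFree-resp : ∀ {x y} → x ≈ y → GFree E q g x → GFree E q g y
  GFree-resp x≈y x-free H v H∈F H-monic H∣g σHv≈y =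
    x-free H v H∈F H-monic H∣g (trans σHv≈y (sym x≈y))

  AdditivelyFree : Carrier → Set
  AdditivelyFree w = w ≉ 0# × GFree E q g w × GFree E q g (w ⁻¹)

  additivelyFree-* : Multiplier u → AdditivelyFree w → AdditivelyFree (u * w)
  additivelyFree-* {u} {w} mu@(u≉0 , _) (w≉0 , w-free , w⁻¹-free) =
    *-≉0 u≉0 w≉0 ,
    gfree-multiplier mu w-free ,
    GFree-resp (sym (⁻¹-distrib-* u≉0 w≉0)) (gfree-multiplier (multiplier-⁻¹ mu) w⁻¹-free)

-- Opened only here, so that _*_ in the field modules above is unambiguously the field multiplication.
open import Data.Nat using (ℕ; zero; suc; _∸_; _≤_; _*_; _^_)
open import Data.Nat.GCD using (gcd)
open import Data.Nat.Divisibility using (_∣_)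
open import Data.Nat.Coprimality using (Coprime)
open import Data.Product using (_×_)
open import Relation.Binary.PropositionalEquality using (_≡_)
import Relation.Binary.PropositionalEquality as ≡
open import Data.Nat.Properties using (0≢1+n)
open import Data.Empty using (⊥-elim)

module Counting (E : FiniteField) (q′ n′ : ℕ) (card≡ : FiniteField.card E ≡ suc q′ ^ suc n′)
                (k : ℕ) (k-def : k * (q′ * gcd (suc n′) q′) ≡ suc q′ ^ suc n′ ∸ 1)
                (R : ℕ) (R∣ : R ∣ suc q′ ^ suc n′ ∸ 1) (R⊥rad[k] : Coprime R (rad k))
                (R-max : ∀ d → d ∣ suc q′ ^ suc n′ ∸ 1 → Coprime d (rad k) → d ≤ R) where

  open FiniteField E
    using (Carrier; _≈_; _≉_; 0#; 1#; _⁻¹; pow; elems; card; setoid; refl; sym; trans; reflexive;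
           *-comm; *-congˡ; *-identityʳ)
    renaming (_*_ to _·_)
  open FieldArithmetic E
  open Enumeration E using (m; index; ≈-lookup-index; index-cong; index-injective; card≡1+m)
  open CyclicUnits E using (m-nonZero)
  open DiscreteLog E
  open Multipliers E q′ n′
  open Arithmetic
  open Sums
  open Totient
  open import Data.Nat as ℕ using (NonZero; _%_; _+_; _<_)
  open import Data.Nat.DivMod using (m%n<n)
  import Data.Nat.Properties as ℕ
  open import Data.Nat.Divisibility using (_∤_; divides; ∣-trans; ∣m⇒∣m*n; ∣n⇒∣m*n; 0∣⇒≡0; _∣?_)
  open import Data.Nat.GCD using (gcd[m,n]∣m; gcd[m,n]∣n)
  import Data.Nat.Coprimality as Coprime
  open import Data.Nat.Coprimality using (coprime?)
  open import Data.Nat.Primality using (Prime)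
  open import Data.Nat.Tactic.RingSolver using (solve-∀)
  open import Data.Fin as Fin using (Fin; toℕ)
  open import Data.Product using (∃; _,_; proj₁)
  open import Function using (_∘_; _⇔_; mk⇔; Equivalence; case_of_)
  import Function.Properties.Equivalence as ⇔
  open import Data.Product.Function.NonDependent.Propositional using (_×-⇔_)
  open import Data.Fin.Subset using (Subset; _∈_; ∣_∣)
  open import Data.Fin.Subset.Properties using (_∈?_)
  open import Data.Fin.Permutation using (Permutation)
  open import Data.List using (lookup)
  import Data.Fin.Properties as Fin
  open import Relation.Nullary using (yes; no)

  private
    q n : ℕ
    q = suc q′
    n = suc n′

  m≡q^n-1 : m ≡ q ^ n ∸ 1
  m≡q^n-1 = ≡.cong (_∸ 1) card≡

  k*q′g≡m : k * (q′ * gcd n q′) ≡ m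
  k*q′g≡m = ≡.trans k-def (≡.sym m≡q^n-1)

  R∣m : R ∣ m
  R∣m = ≡.subst (R ∣_) (≡.sym m≡q^n-1) R∣

  instance
    k-nonZero : NonZero k
    k-nonZero = ℕ.m*n≢0⇒m≢0 k {{≡.subst NonZero (≡.sym k*q′g≡m) m-nonZero}}
    R-nonZero : NonZero R
    R-nonZero = ℕ.≢-nonZero λ { ≡.refl → ℕ.≢-nonZero⁻¹ m (0∣⇒≡0 R∣m) }
    rad[k]-nonZero : NonZero (rad k)
    rad[k]-nonZero = rad-nonZero k

  k∣m : k ∣ m
  k∣m = divides (q′ * gcd n q′) (≡.trans (≡.sym k*q′g≡m) (ℕ.*-comm k _))

  prime∣rad[k]⇒∣k : ∀ {p} → Prime p → p ∣ rad k → p ∣ k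
  prime∣rad[k]⇒∣k pp = Equivalence.to (prime∣rad⇔prime∣ pp)

  R⊥k : Coprime R k
  R⊥k = coprime-∣-primes (λ pp p∣k → Equivalence.from (prime∣rad⇔prime∣ pp) p∣k) R⊥rad[k]

  -- R is the largest divisor of m coprime to rad k, so it absorbs every prime of m not dividing k.
  prime∤k⇒∣R : ∀ {p} → Prime p → p ∣ m → p ∤ k → p ∣ R
  prime∤k⇒∣R {p} pp p∣m p∤k with p ∣? R
  ... | yes p∣R = p∣R
  ... | no p∤R = ⊥-elim (ℕ.<⇒≱ R<pR (R-max (p * R) (≡.subst (p * R ∣_) m≡q^n-1 pR∣m) pR⊥rad[k]))
    where
    pR∣m : p * R ∣ m
    pR∣m = coprime-∣-* (prime-coprime pp p∤R) p∣m R∣m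
    pR⊥rad[k] : Coprime (p * R) (rad k)
    pR⊥rad[k] = coprime-*ˡ (prime-coprime pp (p∤k ∘ prime∣rad[k]⇒∣k pp)) R⊥rad[k]
    R<pR : R < p * R
    R<pR = ≡.subst (R <_) (ℕ.*-comm R p) (ℕ.m<m*n R p (prime>1 pp))

  -- m = k (q - 1) gcd(n, q - 1), so γ^(k t (q - 1)) is killed by the exponents q - 1 and n.
  γ^[kt]-multiplier : ∀ t → Multiplier (pow γ (k * t))
  γ^[kt]-multiplier t = γ^-≉0 (k * t) , c∈F , c^[g∣]≈1 n (gcd[m,n]∣m n q′)
    where
    c : Carrier
    c = pow (pow γ (k * t)) q′
    c^[g∣]≈1 : ∀ x → gcd n q′ ∣ x → pow c x ≈ 1#
    c^[g∣]≈1 x (divides y ≡.refl) = begin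
      pow c (y * gcd n q′)                   ≈⟨ pow-* (pow γ (k * t)) q′ _ ⟨
      pow (pow γ (k * t)) (q′ * (y * gcd n q′)) ≈⟨ pow-* γ (k * t) _ ⟨
      pow γ (k * t * (q′ * (y * gcd n q′)))  ≈⟨ pow≈1-∣ m γ^m≈1 m∣ktq′yg ⟩
      1#                                     ∎
      where
      open import Relation.Binary.Reasoning.Setoid setoid
      rearrange : ∀ k t q y g → k * t * (q * (y * g)) ≡ t * y * (k * (q * g))
      rearrange = solve-∀
      m∣ktq′yg : m ∣ k * t * (q′ * (y * gcd n q′))
      m∣ktq′yg = divides (t * y) (≡.trans (rearrange k t q′ y (gcd n q′)) (≡.cong (t * y *_) k*q′g≡m))
    c∈F : InF E q c
    c∈F = trans (*-congˡ (c^[g∣]≈1 q′ (gcd[m,n]∣n n q′))) (*-identityʳ c)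

  mfree⇒coprime : ∀ {M j} → .{{_ : NonZero M}} → MFree E q M (pow γ j) → Coprime j M
  mfree⇒coprime {M} {j} γʲ-free = coprime-by-primes λ where
    pp (divides c ≡.refl) p∣M → prime≢1 pp (γʲ-free _ (pow γ c) p∣M (sym (pow-* γ c _)))

  coprime⇒mfree : ∀ {M j} → .{{_ : NonZero M}} → (∀ {p} → Prime p → p ∣ M → p ∣ m) →
                  Coprime j M → MFree E q M (pow γ j)
  coprime⇒mfree {M} {j} primes∣m j⊥M d v d∣M vᵈ≈γʲ with d ℕ.≟ 1
  ... | yes d≡1 = d≡1
  ... | no d≢1 with p , pp , p∣d ← prime-factor-of-divisor d∣M d≢1 =
    ⊥-elim (prime≢1 pp (j⊥M (p∣j (primes∣m pp (∣-trans p∣d d∣M)) p∣d , ∣-trans p∣d d∣M)))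
    where
    instance
      d-nonZero : NonZero d
      d-nonZero = ℕ.≢-nonZero λ { ≡.refl → ℕ.≢-nonZero⁻¹ M (0∣⇒≡0 d∣M) }
    v≉0 : v ≉ 0#
    v≉0 v≈0 = γ^-≉0 j (trans (sym vᵈ≈γʲ) (trans (pow-cong d v≈0) (pow-0# d)))
    p∣j : ∀ {p} → p ∣ m → p ∣ d → p ∣ j
    p∣j {p} p∣m p∣d = via-log (discrete-log v≉0)
      where
      via-log : (∃ λ i → pow γ i ≈ v) → p ∣ j
      via-log (i , γⁱ≈v) =
        γ^-≈-∣ p∣m (trans (pow-* γ i d) (trans (pow-cong d γⁱ≈v) vᵈ≈γʲ)) (∣n⇒∣m*n i p∣d)

  NProp-γ^⇔ : ∀ {M} → .{{_ : NonZero M}} → (∀ {p} → Prime p → p ∣ M → p ∣ m) →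
              ∀ j → NProp E q M g g (pow γ j) ⇔ (Coprime j M × AdditivelyFree (pow γ j))
  NProp-γ^⇔ {M} primes∣m j = mk⇔ to from
    where
    to : NProp E q M g g (pow γ j) → Coprime j M × AdditivelyFree (pow γ j)
    to (γʲ≉0 , γʲ-mfree , γʲ-free , γ⁻ʲ-free) =
      mfree⇒coprime γʲ-mfree , γʲ≉0 , γʲ-free , γ⁻ʲ-free
    from : Coprime j M × AdditivelyFree (pow γ j) → NProp E q M g g (pow γ j)
    from (j⊥M , γʲ≉0 , γʲ-free , γ⁻ʲ-free) =
      γʲ≉0 , coprime⇒mfree primes∣m j⊥M , γʲ-free , γ⁻ʲ-free

  coprime-m⇔ : ∀ {j} → Coprime j m ⇔ (Coprime j (rad k) × Coprime j R)
  coprime-m⇔ {j} = mk⇔ to from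
    where
    to : Coprime j m → Coprime j (rad k) × Coprime j R
    to j⊥m = coprime-∣-primes (λ pp p∣rad[k] → ∣-trans (prime∣rad[k]⇒∣k pp p∣rad[k]) k∣m) j⊥m ,
             coprime-∣-primes (λ _ p∣R → ∣-trans p∣R R∣m) j⊥m
    from : Coprime j (rad k) × Coprime j R → Coprime j m
    from (j⊥rad[k] , j⊥R) = coprime-by-primes λ {p} pp p∣j p∣m → case p ∣? k of λ where
      (yes p∣k) → prime≢1 pp (j⊥rad[k] (p∣j , Equivalence.from (prime∣rad⇔prime∣ pp) p∣k))
      (no p∤k)  → prime≢1 pp (j⊥R (p∣j , prime∤k⇒∣R pp p∣m p∤k))

  AdditivelyFree-resp : ∀ {x y} → x ≈ y → AdditivelyFree x → AdditivelyFree y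
  AdditivelyFree-resp {x} x≈y (x≉0 , x-free , x⁻¹-free) =
    ≉0-resp-≈ x≈y x≉0 , GFree-resp x≈y x-free , GFree-resp (⁻¹-cong x≉0 x≈y) x⁻¹-free

  additivelyFree-shift⇔ : ∀ j t → AdditivelyFree (pow γ j) ⇔ AdditivelyFree (pow γ (j + k * t))
  additivelyFree-shift⇔ j t = mk⇔
    (λ γʲ-free → AdditivelyFree-resp γᵏᵗγʲ≈γʲ⁺ᵏᵗ (additivelyFree-* (γ^[kt]-multiplier t) γʲ-free))
    (λ γʲ⁺ᵏᵗ-free → AdditivelyFree-resp γ⁻ᵏᵗγʲ⁺ᵏᵗ≈γʲ
                       (additivelyFree-* (multiplier-⁻¹ (γ^[kt]-multiplier t)) γʲ⁺ᵏᵗ-free))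
    where
    γᵏᵗγʲ≈γʲ⁺ᵏᵗ : pow γ (k * t) · pow γ j ≈ pow γ (j + k * t)
    γᵏᵗγʲ≈γʲ⁺ᵏᵗ = trans (*-comm _ _) (sym (pow-+ γ j (k * t)))
    γ⁻ᵏᵗγʲ⁺ᵏᵗ≈γʲ : pow γ (k * t) ⁻¹ · pow γ (j + k * t) ≈ pow γ j
    γ⁻ᵏᵗγʲ⁺ᵏᵗ≈γʲ = trans (*-congˡ (sym γᵏᵗγʲ≈γʲ⁺ᵏᵗ)) (⁻¹-cancelˡ _ (γ^-≉0 (k * t)))

  NProp-resp : ∀ {M x y} → x ≈ y → NProp E q M g g x → NProp E q M g g y
  NProp-resp {x = x} x≈y (x≉0 , x-mfree , x-free , x⁻¹-free) =
    ≉0-resp-≈ x≈y x≉0 ,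
    (λ d v d∣M vᵈ≈y → x-mfree d v d∣M (trans vᵈ≈y (sym x≈y))) ,
    GFree-resp x≈y x-free ,
    GFree-resp (⁻¹-cong x≉0 x≈y) x⁻¹-free

  module CountedSet (M : ℕ) (S : Subset card) (S⇔ : ∀ i → i ∈ S ⇔ NProp E q M g g (lookup elems i)) where

    index∈S⇔ : ∀ x → index x ∈ S ⇔ NProp E q M g g x
    index∈S⇔ x = mk⇔ (NProp-resp (sym (≈-lookup-index x)) ∘ Equivalence.to (S⇔ (index x)))
                     (Equivalence.from (S⇔ (index x)) ∘ NProp-resp (≈-lookup-index x))

    χ : ℕ → ℕ
    χ j = 𝟙 (index (pow γ j) ∈? S)

    ∣S∣≡∑χ : ∣ S ∣ ≡ ∑[ j < m ] χ (toℕ j)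
    ∣S∣≡∑χ = begin
      ∣ S ∣                                         ≡⟨ ∣S∣≡∑𝟙 S ⟩
      ∑[ i < card ] 𝟙 (i ∈? S)                      ≡⟨ sum-permute (λ i → 𝟙 (i ∈? S)) embed-permutation ⟩
      𝟙 (index 0# ∈? S) + ∑[ j < m ] χ (toℕ j)     ≡⟨ ≡.cong (_+ ∑[ j < m ] χ (toℕ j)) 0∉S ⟩
      ∑[ j < m ] χ (toℕ j)                          ∎
      where
      open ≡.≡-Reasoning
      embed : Fin (suc m) → Fin card
      embed Fin.zero    = index 0#
      embed (Fin.suc j) = index (pow γ (toℕ j))
      embed-injective : ∀ {i j} → embed i ≡ embed j → i ≡ j
      embed-injective {Fin.zero}  {Fin.zero}  _ = ≡.refl
      embed-injective {Fin.zero}  {Fin.suc j} eq = ⊥-elim (γ^-≉0 (toℕ j) (sym (index-injective eq)))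
      embed-injective {Fin.suc i} {Fin.zero}  eq = ⊥-elim (γ^-≉0 (toℕ i) (index-injective eq))
      embed-injective {Fin.suc i} {Fin.suc j} eq =
        ≡.cong Fin.suc (Fin.toℕ-injective (γ^-injective (Fin.toℕ<n i) (Fin.toℕ<n j) (index-injective eq)))
      embed-permutation : Permutation (suc m) card
      embed-permutation = injective⇒permutation embed (≡.sym card≡1+m) embed-injective
      0∉S : 𝟙 (index 0# ∈? S) ≡ 0
      0∉S with index 0# ∈? S
      ... | yes 0∈S = ⊥-elim (proj₁ (Equivalence.to (index∈S⇔ 0#) 0∈S) refl)
      ... | no _    = ≡.refl

  prime∣rad[k]⇒∣m : ∀ {p} → Prime p → p ∣ rad k → p ∣ m
  prime∣rad[k]⇒∣m pp p∣rad[k] = ∣-trans (prime∣rad[k]⇒∣k pp p∣rad[k]) k∣m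

  module TwoCounts (Sa : Subset card) (Sa⇔ : ∀ i → i ∈ Sa ⇔ NProp E q (rad k) g g (lookup elems i))
               (Sb : Subset card) (Sb⇔ : ∀ i → i ∈ Sb ⇔ NProp E q m g g (lookup elems i)) where

    module A = CountedSet (rad k) Sa Sa⇔
    module B = CountedSet m Sb Sb⇔

    C : ℕ → ℕ
    C x = 𝟙 (coprime? x R)

    γ^∈Sa⇔ : ∀ x → index (pow γ x) ∈ Sa ⇔ (Coprime x (rad k) × AdditivelyFree (pow γ x))
    γ^∈Sa⇔ x = ⇔.trans (A.index∈S⇔ (pow γ x)) (NProp-γ^⇔ prime∣rad[k]⇒∣m x)

    γ^∈Sb⇔ : ∀ x → index (pow γ x) ∈ Sb ⇔ (Coprime x R × index (pow γ x) ∈ Sa)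
    γ^∈Sb⇔ x = ⇔.trans (B.index∈S⇔ (pow γ x)) (⇔.trans (NProp-γ^⇔ (λ _ p∣m → p∣m) x)
      (⇔.trans (coprime-m⇔ ×-⇔ ⇔.refl) (⇔.trans ×-swap-assoc (⇔.refl ×-⇔ ⇔.sym (γ^∈Sa⇔ x)))))
      where
      ×-swap-assoc : ∀ {P Q S : Set} → ((P × Q) × S) ⇔ (Q × (P × S))
      ×-swap-assoc = mk⇔ (λ ((p , q) , s) → q , p , s) (λ (q , p , s) → (p , q) , s)

    A-shift : ∀ j t → A.χ (j + k * t) ≡ A.χ j
    A-shift j t = 𝟙-cong γ^[j+kt]∈Sa⇔γ^j∈Sa (index (pow γ (j + k * t)) ∈? Sa) (index (pow γ j) ∈? Sa)
      where
      primes∣kt : ∀ {p} → Prime p → p ∣ rad k → p ∣ k * t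
      primes∣kt pp p∣rad[k] = ∣m⇒∣m*n t (prime∣rad[k]⇒∣k pp p∣rad[k])
      γ^[j+kt]∈Sa⇔γ^j∈Sa : index (pow γ (j + k * t)) ∈ Sa ⇔ index (pow γ j) ∈ Sa
      γ^[j+kt]∈Sa⇔γ^j∈Sa = ⇔.trans (γ^∈Sa⇔ (j + k * t))
        (⇔.trans (coprime-+-multiple⇔ primes∣kt ×-⇔ ⇔.sym (additivelyFree-shift⇔ j t)) (⇔.sym (γ^∈Sa⇔ j)))

    B≡C*A : ∀ x → B.χ x ≡ C x * A.χ x
    B≡C*A x = 𝟙-× (γ^∈Sb⇔ x) (index (pow γ x) ∈? Sb) (coprime? x R) (index (pow γ x) ∈? Sa)

    B-shift : ∀ j t → B.χ ((k * t + 1 * j) % m) ≡ C (j + k * t) * A.χ j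
    B-shift j t = begin
      B.χ ((k * t + 1 * j) % m)   ≡⟨ ≡.cong (λ i → 𝟙 (i ∈? Sb)) (index-cong γ^[[kt+j]%m]≈γ^[j+kt]) ⟩
      B.χ (j + k * t)             ≡⟨ B≡C*A (j + k * t) ⟩
      C (j + k * t) * A.χ (j + k * t) ≡⟨ ≡.cong (C (j + k * t) *_) (A-shift j t) ⟩
      C (j + k * t) * A.χ j       ∎
      where
      open ≡.≡-Reasoning
      rearrange : ∀ j c → c + 1 * j ≡ j + c
      rearrange = solve-∀
      γ^[[kt+j]%m]≈γ^[j+kt] : pow γ ((k * t + 1 * j) % m) ≈ pow γ (j + k * t)
      γ^[[kt+j]%m]≈γ^[j+kt] = trans (sym (γ^-% _)) (reflexive (≡.cong (pow γ) (rearrange j (k * t))))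

    ∑C-affine≡φ : ∀ j → ∑[ t < R ] C (j + k * toℕ t) ≡ φ R
    ∑C-affine≡φ j = ≡.trans (∑𝟙-coprime-affine R⊥k j) (≡.sym (φ≡∑𝟙-coprime R))

    φR*∣Sa∣≡R*∣Sb∣ : φ R * ∣ Sa ∣ ≡ R * ∣ Sb ∣
    φR*∣Sa∣≡R*∣Sb∣ = begin
      φ R * ∣ Sa ∣
        ≡⟨ ≡.cong (φ R *_) A.∣S∣≡∑χ ⟩
      φ R * ∑[ j < m ] A.χ (toℕ j)
        ≡⟨ *-distribˡ-sum {m} (φ R) (A.χ ∘ toℕ) ⟩
      ∑[ j < m ] (φ R * A.χ (toℕ j))
        ≡⟨ sum-cong-≗ {m} (λ j → ≡.cong (_* A.χ (toℕ j)) (∑C-affine≡φ (toℕ j))) ⟨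
      ∑[ j < m ] ((∑[ t < R ] C (toℕ j + k * toℕ t)) * A.χ (toℕ j))
        ≡⟨ sum-cong-≗ {m} (λ j → *-distribʳ-sum {R} (A.χ (toℕ j)) (λ t → C (toℕ j + k * toℕ t))) ⟩
      ∑[ j < m ] ∑[ t < R ] (C (toℕ j + k * toℕ t) * A.χ (toℕ j))
        ≡⟨ ∑-comm {m} {R} (λ j t → C (toℕ j + k * toℕ t) * A.χ (toℕ j)) ⟩
      ∑[ t < R ] ∑[ j < m ] (C (toℕ j + k * toℕ t) * A.χ (toℕ j))
        ≡⟨ sum-cong-≗ {R} (λ t → sum-cong-≗ {m} (λ j → B-shift (toℕ j) (toℕ t))) ⟨
      ∑[ t < R ] ∑[ j < m ] B.χ ((k * toℕ t + 1 * toℕ j) % m)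
        ≡⟨ sum-cong-≗ {R} (λ t → ∑-reindex B.χ (λ j → (k * toℕ t + 1 * j) % m) (λ _ → m%n<n _ m)
                                   (+-*-%-injective {c = k * toℕ t} (Coprime.sym (Coprime.1-coprimeTo m)))) ⟩
      ∑[ t < R ] ∑[ j < m ] B.χ (toℕ j)
        ≡⟨ sum-cong-≗ {R} (λ _ → B.∣S∣≡∑χ) ⟨
      ∑[ t < R ] ∣ Sb ∣
        ≡⟨ ∑-const R ∣ Sb ∣ ⟩
      R * ∣ Sb ∣
        ∎
      where open ≡.≡-Reasoning

  φR*a≡R*b : ∀ {a b} → HasCountN E q (rad k) g g a → HasCountN E q (q ^ n ∸ 1) g g b → φ R * a ≡ R * b
  φR*a≡R*b (Sa , Sa⇔ , ≡.refl) (Sb , Sb⇔ , ≡.refl) =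
    TwoCounts.φR*∣Sa∣≡R*∣Sb∣ Sa Sa⇔ Sb (≡.subst (λ M → ∀ i → i ∈ Sb ⇔ NProp E q M g g (lookup elems i))
                                            (≡.sym m≡q^n-1) Sb⇔)

lemma2p4 : (q n : ℕ) → IsPrimePower q → 1 ≤ n →
    (E : FiniteField) → FiniteField.card E ≡ q ^ n →
    (k : ℕ) → k * ((q ∸ 1) * gcd n (q ∸ 1)) ≡ q ^ n ∸ 1 →
    (R : ℕ) → R ∣ (q ^ n ∸ 1) → Coprime R (rad k) →
    (∀ d → d ∣ (q ^ n ∸ 1) → Coprime d (rad k) → d ≤ R) →
    (a b : ℕ) →
    HasCountN E q (rad k) (xⁿ-1 E q n) (xⁿ-1 E q n) a →
    HasCountN E q (q ^ n ∸ 1) (xⁿ-1 E q n) (xⁿ-1 E q n) b →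
    φ R * a ≡ R * b
lemma2p4 q           zero     _ ()
lemma2p4 zero        (suc n′) _ _ E card≡0 =
  ⊥-elim (0≢1+n (≡.trans (≡.sym card≡0) (Enumeration.card≡1+m E)))
lemma2p4 (suc q′)    (suc n′) _ _ E card≡ k k-def R R∣ R⊥rad[k] R-max a b =
  Counting.φR*a≡R*b E q′ n′ card≡ k k-def R R∣ R⊥rad[k] R-max
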